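{- Let $\lambda$ be a partition of $n$ and $j=n-\lambda_1$. Let $1\le k\le n$ and let $\mu$ be a partition of $n-k$ with $\mu\subseteq\lambda$, and set $l=k-\lambda_1+\mu_1$. If $l>0$, then $$d_\mu\,d_{\lambda\setminus\mu}\le\Big(\frac{4^j k}{n}\Big)^l d_\lambda.$$
   Context: $\lambda_1$ and $\mu_1$ denote the first (largest) parts ($\mu_1=0$ if $\mu$ is empty). Partitions are identified with Young diagrams and $\mu\subseteq\lambda$ means containment of diagrams. $d_\nu$ is the number of standard Young tableaux of shape $\nu$ ($d_\emptyset=1$); $d_{\lambda\setminus\mu}$ is the number of standard skew tableaux of shape $\lambda/\mu$, i.e. fillings of the boxes of $\lambda$ not in $\mu$ with $1,\dots,k$, each once, increasing along rows and down columns. -}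

module Defs where

open import Data.Nat using (ℕ; zero; suc; _+_; _*_; _∸_; _≤_; _<_; _≥_; _≡ᵇ_; _<ᵇ_)
open import Data.Bool using (Bool; true; false; _∧_; _∨_; not; if_then_else_)
open import Data.List using (List; []; _∷_; length; concat; concatMap; map; upTo; applyUpTo; lookup)
open import Data.List.Relation.Unary.All using (All)
open import Data.List.Relation.Unary.Linked using (Linked)
open import Data.Product using (_×_; _,_)
open import Data.Nat.ListAction using (sum)

IsPartition : List ℕ → Set
IsPartition λ′ = Linked _≥_ λ′ × All (λ x → 0 < x) λ′

size : List ℕ → ℕ
size = sum

-- i-th part (0-indexed), 0 beyond the length; so row ν 0 = ν₁ (= 0 if ν empty)
row : List ℕ → ℕ → ℕ
row []       _       = 0
row (x ∷ xs) zero    = x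
row (x ∷ xs) (suc i) = row xs i

_⊆ᴾ_ : List ℕ → List ℕ → Set
μ ⊆ᴾ λ′ = ∀ i → row μ i ≤ row λ′ i

-- boxes of λ/μ as (row, column), 0-indexed: i < ℓ(λ), row μ i ≤ c < row λ i
range : ℕ → ℕ → List ℕ
range a b = applyUpTo (a +_) (b ∸ a)

boxes : List ℕ → List ℕ → List (ℕ × ℕ)
boxes λ′ μ = concatMap (λ i → map (λ c → (i , c)) (range (row μ i) (row λ′ i))) (upTo (length λ′))

-- A filling of λ/μ: a list of rows; row i lists the entries of boxes
-- (i , row μ i), (i , row μ i + 1), ..., (i , row λ i - 1) in order.
Filling : Set
Filling = List (List ℕ)

getL : List ℕ → ℕ → ℕ
getL []       _       = 0
getL (x ∷ xs) zero    = x
getL (x ∷ xs) (suc i) = getL xs i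

getR : Filling → ℕ → List ℕ
getR []       _       = []
getR (r ∷ rs) zero    = r
getR (r ∷ rs) (suc i) = getR rs i

entry : List ℕ → Filling → ℕ × ℕ → ℕ
entry μ T (i , c) = getL (getR T i) (c ∸ row μ i)

listsOf : ℕ → List ℕ → List (List ℕ)
listsOf zero    xs = [] ∷ []
listsOf (suc m) xs = concatMap (λ x → map (x ∷_) (listsOf m xs)) xs

productRows : List ℕ → List ℕ → List Filling
productRows []       xs = [] ∷ []
productRows (m ∷ ms) xs = concatMap (λ r → map (r ∷_) (productRows ms xs)) (listsOf m xs)

candidates : List ℕ → List ℕ → ℕ → List Filling
candidates λ′ μ k =
  productRows (map (λ i → row λ′ i ∸ row μ i) (upTo (length λ′))) (applyUpTo suc k)

elem : ℕ → List ℕ → Bool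
elem x []       = false
elem x (y ∷ ys) = (x ≡ᵇ y) ∨ elem x ys

distinct : List ℕ → Bool
distinct []       = true
distinct (x ∷ xs) = not (elem x xs) ∧ distinct xs

allB : {A : Set} → (A → Bool) → List A → Bool
allB p []       = true
allB p (x ∷ xs) = p x ∧ allB p xs

comparable : ℕ × ℕ → ℕ × ℕ → Bool
comparable (i , c) (i′ , c′) = ((i ≡ᵇ i′) ∧ (c <ᵇ c′)) ∨ ((c ≡ᵇ c′) ∧ (i <ᵇ i′))

-- standard: every value 1..k used exactly once (entries lie in 1..k and the
-- number of boxes is k, so distinctness suffices), increasing along rows and
-- down columns
isStandard : List ℕ → List ℕ → Filling → Bool
isStandard λ′ μ T =
  distinct (concat T) ∧
  allB (λ a → allB (λ b → if comparable a b then entry μ T a <ᵇ entry μ T b else true)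
                   (boxes λ′ μ))
       (boxes λ′ μ)

countB : {A : Set} → (A → Bool) → List A → ℕ
countB p []       = 0
countB p (x ∷ xs) = (if p x then 1 else 0) + countB p xs

dSkew : List ℕ → List ℕ → ℕ
dSkew λ′ μ = countB (isStandard λ′ μ) (candidates λ′ μ (size λ′ ∸ size μ))

d : List ℕ → ℕ
d ν = dSkew ν []

{-# OPTIONS --safe #-}

-- A standard filling of λ/μ has its largest entry in a corner, so removing that box recursively
-- identifies d_{λ∖μ} with the number of paths from λ down to μ in Young's lattice. Writing ν̄ for ν
-- without its first row (so j = |λ̄| and l = |λ̄| - |μ̄|), the paths satisfy
--   (1) d_μ d_{λ∖μ} ≤ d_λ,
--   (2) d_{λ∖μ} ≤ C(k,l) d_{λ̄∖μ̄} and d_μ ≤ C(|μ|,|μ̄|) d_μ̄, since a filling is determined by the set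
--       of entries below its first row and by the filling they form there,
--   (3) C(λ₁,j) d_λ̄ ≤ d_λ.
-- If n ≤ 4^j k then (1) suffices. Otherwise 4j < n, and (2), (1) for μ̄ ⊆ λ̄ and (3) reduce the claim
-- to C(|μ|,|μ̄|) C(k,l) n^l ≤ (4^j k)^l C(λ₁,j), which holds as C(λ₁,j) j! ≥ (λ₁+1-j)^j ≥ (n/2)^j.

module Submission where

open import Defs
open import Data.Nat using (ℕ; _+_; _*_; _∸_; _^_; _≤_; _<_)
open import Data.List using (List)
open import Relation.Binary.PropositionalEquality using (_≡_)

open import Data.Bool using (Bool; true; false; T; if_then_else_; not; _∧_)
open import Data.Bool.Properties using (T-∧; T-∨; T-≡)
open import Data.Empty using (⊥-elim)
open import Data.List
  using ([]; _∷_; _++_; drop; length; map; filterᵇ; concatMap; concat; applyUpTo; upTo;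
        cartesianProductWith)
import Data.List.Fresh as List#
open import Data.List.Fresh.Relation.Unary.Any using (here; there)
open import Data.List.Membership.Propositional using (_∈_; _∉_)
open import Data.List.Membership.Propositional.Properties
  using (∈-++⁻; ∈-++⁺ˡ; ∈-++⁺ʳ; ∈-cartesianProductWith⁺; ∈-cartesianProductWith⁻; ∈-filter⁺;
        ∈-filter⁻; ∈-map⁺; ∈-map⁻; ∈-applyUpTo⁺; ∈-applyUpTo⁻; ∈-concat⁺′; ∈-concat⁻′; ∈-upTo⁺)
open import Data.List.Properties
  using (map-cong-local; length-applyUpTo; ++-assoc; length-++; map-cong; length-map; map-∘;
        map-id-local; ∷-injective; length-upTo)
open import Data.List.Relation.Binary.Disjoint.Propositional using (Disjoint)
open import Data.List.Relation.Binary.Permutation.Propositional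
  using (_↭_; ↭-trans; ↭-reflexive; ↭-sym; ↭⇒↭ₛ)
import Data.List.Relation.Binary.Permutation.Propositional.Properties as ↭
open import Data.List.Relation.Binary.Sublist.Propositional
  using (_⊆_; []; _∷_; _∷ʳ_; minimum; ⊆-refl)
import Data.List.Relation.Binary.Sublist.Propositional.Properties as Sublist
open import Data.List.Relation.Unary.All as All using (All; []; _∷_)
import Data.List.Relation.Unary.All.Properties as All
open import Data.List.Relation.Unary.AllPairs as AllPairs using ([]; _∷_)
import Data.List.Relation.Unary.AllPairs.Properties as AllPairs
open import Data.List.Relation.Unary.Any using (here; there)
open import Data.List.Relation.Unary.Linked using ([]; [-]; _∷_)
open import Data.List.Relation.Unary.Unique.Propositional using (Unique)
import Data.List.Relation.Unary.Unique.Propositional.Properties as Unique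
open import Data.Nat using (NonZero; >-nonZero; _!; pred; zero; suc; s≤s; z≤n; _<ᵇ_)
open import Data.Nat.Combinatorics
  using (_C_; nCk+nC[k+1]≡[n+1]C[k+1]; k>n⇒nCk≡0; nCn≡1; nC1≡n; nCk≡nC[n∸k])
open import Data.Nat.ListAction using (sum)
open import Data.Nat.Properties
  using (+-commutativeSemigroup; *-comm; m<n⇒0<n∸m; +-cancelˡ-≡; +-monoˡ-≤; *-distribʳ-+; m<m+n;
        0≢1+n; *-cancelʳ-≤; *-monoˡ-≤; ^-distribˡ-+-*; m*n≢0; +-cancelʳ-<; m^n≢0; *-suc; _!≢0;
        m≤n⇒m<n∨m≡n; m+n∸n≡m; *-assoc; *-monoʳ-≤; *-mono-≤; ^-monoˡ-≤; m≤m*n; m≤n*m; m^n>0;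
        *-identityʳ; m≤n+m; +-monoʳ-≤; module ≤-Reasoning; n∸n≡0; +-cancelʳ-≡; n<1+n; m∸n≢0⇒n<m;
        m+n∸m≡n; +-mono-<-≤; +-mono-≤-<; n≤0⇒n≡0; m∸n+n≡m; +-assoc; 1+n≰n; +-comm; +-∸-assoc;
        <-≤-trans; n≤1+n; <⇒≤pred; 1+n≢n; pred[n]≤n; +-mono-≤; *-distribˡ-+; *-zeroʳ; +-suc; _≟_;
        ≤-refl; ≤∧≢⇒<; ≤-pred; m≤n⇒∃[o]m+o≡n; +-identityʳ; ≡ᵇ⇒≡; ≡⇒≡ᵇ; <ᵇ⇒<; <⇒<ᵇ; m≤m+n;
        +-monoʳ-<; m+[n∸m]≡n; ∸-monoˡ-<; ≤-<-trans; m≤n⇒m∸n≡0; <⇒≤; ≰⇒>; n≮0; _≤?_; _<?_; ≮⇒≥;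
        <-irrefl; 0∸n≡0; <⇒≢; m∸n≤m; suc-injective; ≤-antisym; ≤-trans; ≤-reflexive)
open import Data.Nat.Tactic.RingSolver using (solve-∀)
open import Data.Product using (_×_; _,_; proj₁; proj₂; ∃₂; ∃)
open import Data.Sum using (_⊎_; inj₁; inj₂)
open import Data.Unit using (⊤; tt)
open import Function using (_∘_; id; case_of_)
open import Function.Bundles using (_⇔_; mk⇔; Equivalence)
open import Relation.Binary.PropositionalEquality
  using (_≢_; module ≡-Reasoning; refl; sym; trans; cong; cong₂; subst; subst₂; setoid)
open import Relation.Nullary using (¬_; Dec; yes; no)
open import Relation.Nullary.Decidable using (T?; _×-dec_)

open import Algebra.Properties.CommutativeSemigroup +-commutativeSemigroup using (interchange)
open import Data.List.Membership.DecPropositional _≟_ using (_∈?_)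
open import Data.List.Relation.Binary.Permutation.Setoid.Properties (setoid ℕ) using (Unique-resp-↭)


private
  variable
    A B Z : Set
    xs ys : List A

open Equivalence using (to; from)


-- Counting in lists

module _ {A : Set} where
  open import Data.List.Fresh.Membership.Setoid (setoid A) renaming (_∈_ to _∈#_)
  open import Data.List.Fresh.Membership.Setoid.Properties (setoid A) using (injection)

  private
    length-fromList : {xs : List A} (u : Unique xs) → List#.length (List#.fromList u) ≡ length xs
    length-fromList []      = refl
    length-fromList (_ ∷ u) = cong suc (length-fromList u)

    ∈-fromList⁺ : {xs : List A} (u : Unique xs) → ∀ {x} → x ∈ xs → x ∈# List#.fromList u
    ∈-fromList⁺ (_ ∷ u) (here x≡y) = here x≡y
    ∈-fromList⁺ (_ ∷ u) (there x∈) = there (∈-fromList⁺ u x∈)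

    ∈-fromList⁻ : {xs : List A} (u : Unique xs) → ∀ {x} → x ∈# List#.fromList u → x ∈ xs
    ∈-fromList⁻ (_ ∷ u) (here x≡y) = here x≡y
    ∈-fromList⁻ (_ ∷ u) (there x∈) = there (∈-fromList⁻ u x∈)

  Unique-length-≤ : {xs ys : List A} → Unique xs → Unique ys → (∀ {x} → x ∈ xs → x ∈ ys) →
    length xs ≤ length ys
  Unique-length-≤ uxs uys xs⊆ys =
    subst₂ _≤_ (length-fromList uxs) (length-fromList uys)
      (injection (λ x≢y → x≢y) (∈-fromList⁺ uys ∘ xs⊆ys ∘ ∈-fromList⁻ uxs))

countB≡length-filterᵇ : (p : A → Bool) (xs : List A) → countB p xs ≡ length (filterᵇ p xs)
countB≡length-filterᵇ p []       = refl
countB≡length-filterᵇ p (x ∷ xs) with p x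
... | true  = cong suc (countB≡length-filterᵇ p xs)
... | false = countB≡length-filterᵇ p xs

module _ {p : A → Bool} {q : B → Bool} (f : A → B) (g : B → A) where

  countB-injection : Unique xs → Unique ys →
    (∀ {x} → x ∈ xs → T (p x) → f x ∈ ys × T (q (f x)) × g (f x) ≡ x) →
    countB p xs ≤ countB q ys
  countB-injection {xs} {ys} uxs uys inj =
    subst₂ _≤_ (trans (length-map f (filterᵇ p xs)) (sym (countB≡length-filterᵇ p xs)))
               (sym (countB≡length-filterᵇ q ys))
      (Unique-length-≤ (Unique.map⁻ (subst Unique (sym g∘f≡id) (Unique.filter⁺ (T? ∘ p) uxs)))
                       (Unique.filter⁺ (T? ∘ q) uys)
                       image⊆)
    where
    g∘f≡id : map g (map f (filterᵇ p xs)) ≡ filterᵇ p xs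
    g∘f≡id = trans (sym (map-∘ (filterᵇ p xs))) (map-id-local (All.tabulate λ x∈ →
      let x∈xs , px = ∈-filter⁻ (T? ∘ p) x∈ in proj₂ (proj₂ (inj x∈xs px))))
    image⊆ : ∀ {y} → y ∈ map f (filterᵇ p xs) → y ∈ filterᵇ q ys
    image⊆ y∈ with x , x∈ , refl ← ∈-map⁻ f y∈ =
      let x∈xs , px = ∈-filter⁻ (T? ∘ p) x∈ ; fx∈ys , qfx , _ = inj x∈xs px
      in ∈-filter⁺ (T? ∘ q) fx∈ys qfx

countB-bijection : ∀ {p : A → Bool} {q : B → Bool} {xs ys} (f : A → B) (g : B → A) → Unique xs → Unique ys →
  (∀ {x} → x ∈ xs → T (p x) → f x ∈ ys × T (q (f x)) × g (f x) ≡ x) →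
  (∀ {y} → y ∈ ys → T (q y) → g y ∈ xs × T (p (g y)) × f (g y) ≡ y) →
  countB p xs ≡ countB q ys
countB-bijection f g uxs uys f-ok g-ok =
  ≤-antisym (countB-injection f g uxs uys f-ok) (countB-injection g f uys uxs g-ok)

countB-++ : ∀ (p : A → Bool) xs ys → countB p (xs ++ ys) ≡ countB p xs + countB p ys
countB-++ p []       ys = refl
countB-++ p (x ∷ xs) ys =
  trans (cong ((if p x then 1 else 0) +_) (countB-++ p xs ys)) (sym (+-assoc (if p x then 1 else 0) _ _))

countB-map : ∀ (p : B → Bool) (f : A → B) xs → countB p (map f xs) ≡ countB (p ∘ f) xs
countB-map p f []       = refl
countB-map p f (x ∷ xs) = cong ((if p (f x) then 1 else 0) +_) (countB-map p f xs)

module _ (L : A → List B) where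

  tagged : List A → List (A × B)
  tagged = concatMap (λ i → map (i ,_) (L i))

  ∈-tagged⁻ : ∀ is {i x} → (i , x) ∈ tagged is → i ∈ is × x ∈ L i
  ∈-tagged⁻ is ix∈ with ∈-concat⁻′ (map (λ i → map (i ,_) (L i)) is) ix∈
  ... | _ , ix∈Lj , Lj∈ with ∈-map⁻ (λ i → map (i ,_) (L i)) Lj∈
  ... | j , j∈ , refl with ∈-map⁻ (j ,_) ix∈Lj
  ... | x , x∈ , refl = j∈ , x∈

  ∈-tagged⁺ : ∀ {is i x} → i ∈ is → x ∈ L i → (i , x) ∈ tagged is
  ∈-tagged⁺ {i = i} i∈ x∈ = ∈-concat⁺′ (∈-map⁺ (i ,_) x∈) (∈-map⁺ (λ i → map (i ,_) (L i)) i∈)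

  Unique-tagged : ∀ {is} → Unique is → (∀ i → Unique (L i)) → Unique (tagged is)
  Unique-tagged uis uL = Unique.concat⁺ (All.map⁺ (All.universal (λ i → Unique.map⁺ (cong proj₂) (uL i)) _))
    (AllPairs.map⁺ (AllPairs.map disjoint uis))
    where
    disjoint : ∀ {i j} → i ≢ j → Disjoint (map (i ,_) (L i)) (map (j ,_) (L j))
    disjoint i≢j (ix∈ , ix∈′) with ∈-map⁻ _ ix∈ | ∈-map⁻ _ ix∈′
    ... | _ , _ , refl | _ , _ , ix≡ = i≢j (cong proj₁ ix≡)

  countB-tagged : ∀ (q : A × B → Bool) is → countB q (tagged is) ≡ sum (map (λ i →
    countB (q ∘ (i ,_)) (L i)) is)
  countB-tagged q []       = refl
  countB-tagged q (i ∷ is) = trans (countB-++ q (map (i ,_) (L i)) (tagged is))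
                                   (cong₂ _+_ (countB-map q (i ,_) (L i)) (countB-tagged q is))

sum-map-mono : ∀ {f g : A → ℕ} xs → (∀ {x} → x ∈ xs → f x ≤ g x) → sum (map f xs) ≤ sum (map g xs)
sum-map-mono []       f≤g = z≤n
sum-map-mono (x ∷ xs) f≤g = +-mono-≤ (f≤g (here refl)) (sum-map-mono xs (f≤g ∘ there))

*-sum-map : ∀ a (f : A → ℕ) xs → a * sum (map f xs) ≡ sum (map (λ x → a * f x) xs)
*-sum-map a f []       = *-zeroʳ a
*-sum-map a f (x ∷ xs) = trans (*-distribˡ-+ a (f x) _) (cong (a * f x +_) (*-sum-map a f xs))

sum-map-⊆ : ∀ (f : A → ℕ) {xs ys} → xs ⊆ ys → sum (map f xs) ≤ sum (map f ys)
sum-map-⊆ f []         = z≤n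
sum-map-⊆ f (y ∷ʳ xs⊆) = ≤-trans (sum-map-⊆ f xs⊆) (m≤n+m _ (f y))
sum-map-⊆ f (refl ∷ xs⊆) = +-monoʳ-≤ _ (sum-map-⊆ f xs⊆)

∀∉⇒≡[] : ∀ {xs : List A} → (∀ {x} → x ∉ xs) → xs ≡ []
∀∉⇒≡[] {xs = []}    _  = refl
∀∉⇒≡[] {xs = _ ∷ _} ∉xs = ⊥-elim (∉xs (here refl))

T-not : ∀ {b} → T (not b) ⇔ (¬ T b)
T-not {true}  = mk⇔ (λ ()) (λ ¬t → ¬t tt)
T-not {false} = mk⇔ (λ _ ()) (λ _ → tt)

T-elem : ∀ {x} xs → T (elem x xs) ⇔ x ∈ xs
T-elem []       = mk⇔ (λ ()) (λ ())
T-elem {x} (y ∷ ys) = mk⇔ ⇒ ⇐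
  where
  ⇒ : T (elem x (y ∷ ys)) → x ∈ y ∷ ys
  ⇒ t with to T-∨ t
  ... | inj₁ x≡ᵇy = here (≡ᵇ⇒≡ x y x≡ᵇy)
  ... | inj₂ x∈ys = there (to (T-elem ys) x∈ys)
  ⇐ : x ∈ y ∷ ys → T (elem x (y ∷ ys))
  ⇐ (here x≡y)  = from T-∨ (inj₁ (≡⇒≡ᵇ x y x≡y))
  ⇐ (there x∈ys) = from T-∨ (inj₂ (from (T-elem ys) x∈ys))

T-distinct : (xs : List ℕ) → T (distinct xs) ⇔ Unique xs
T-distinct []       = mk⇔ (λ _ → []) (λ _ → tt)
T-distinct (x ∷ xs) = mk⇔ ⇒ ⇐
  where
  ⇒ : T (distinct (x ∷ xs)) → Unique (x ∷ xs)
  ⇒ t = let x∉xs , dxs = to T-∧ t in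
    All.¬Any⇒All¬ xs (to T-not x∉xs ∘ from (T-elem xs)) ∷ to (T-distinct xs) dxs
  ⇐ : Unique (x ∷ xs) → T (distinct (x ∷ xs))
  ⇐ u@(_ ∷ uxs) = from T-∧ (from T-not (Unique.Unique[x∷xs]⇒x∉xs u ∘ to (T-elem xs)) , from (T-distinct xs) uxs)

T-allB : ∀ {p : A → Bool} xs → T (allB p xs) ⇔ All (T ∘ p) xs
T-allB []       = mk⇔ (λ _ → []) (λ _ → tt)
T-allB (x ∷ xs) = mk⇔ (λ t → let px , pxs = to T-∧ t in px ∷ to (T-allB xs) pxs)
                      (λ { (px ∷ pxs) → from T-∧ (px , from (T-allB xs) pxs) })

T-implies : ∀ {b c} → T (if b then c else true) ⇔ (T b → T c)
T-implies {true}  = mk⇔ (λ t _ → t) (λ f → f tt)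
T-implies {false} = mk⇔ (λ _ ()) (λ _ → tt)

SkewBox : List ℕ → List ℕ → ℕ × ℕ → Set
SkewBox λ′ μ (i , c) = row μ i ≤ c × c < row λ′ i

infix 4 _◁_

data _◁_ : ℕ × ℕ → ℕ × ℕ → Set where
  leftOf : ∀ {i c c′} → c < c′ → (i , c) ◁ (i , c′)
  above  : ∀ {i i′ c} → i < i′ → (i , c) ◁ (i′ , c)

Increasing : List ℕ → List ℕ → Filling → Set
Increasing λ′ μ F = ∀ {a b} → SkewBox λ′ μ a → SkewBox λ′ μ b → a ◁ b → entry μ F a < entry μ F b

IsStandard : List ℕ → List ℕ → Filling → Set
IsStandard λ′ μ F = Unique (concat F) × Increasing λ′ μ F

T-comparable : ∀ a b → T (comparable a b) ⇔ a ◁ b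
T-comparable (i , c) (i′ , c′) = mk⇔ ⇒ ⇐
  where
  ⇒ : T (comparable (i , c) (i′ , c′)) → (i , c) ◁ (i′ , c′)
  ⇒ t with to T-∨ t
  ... | inj₁ t₁ with to T-∧ t₁
  ... | i≡i′ , c<c′ with refl ← ≡ᵇ⇒≡ i i′ i≡i′ = leftOf (<ᵇ⇒< c c′ c<c′)
  ⇒ t | inj₂ t₂ with to T-∧ t₂
  ... | c≡c′ , i<i′ with refl ← ≡ᵇ⇒≡ c c′ c≡c′ = above (<ᵇ⇒< i i′ i<i′)
  ⇐ : (i , c) ◁ (i′ , c′) → T (comparable (i , c) (i′ , c′))
  ⇐ (leftOf c<c′) = from T-∨ (inj₁ (from T-∧ (≡⇒≡ᵇ i i refl , <⇒<ᵇ c<c′)))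
  ⇐ (above i<i′)  = from T-∨ (inj₂ (from T-∧ (≡⇒≡ᵇ c c refl , <⇒<ᵇ i<i′)))

row-beyond : ∀ ν {i} → length ν ≤ i → row ν i ≡ 0
row-beyond []      _         = refl
row-beyond (_ ∷ ν) (s≤s ν≤i) = row-beyond ν ν≤i

row>0⇒<length : ∀ ν {i} → 0 < row ν i → i < length ν
row>0⇒<length ν {i} row>0 with i <? length ν
... | yes i<ℓ = i<ℓ
... | no  i≮ℓ = ⊥-elim (<-irrefl (sym (row-beyond ν (≮⇒≥ i≮ℓ))) row>0)

∈-range⇔ : ∀ {a b c} → c ∈ range a b ⇔ (a ≤ c × c < b)
∈-range⇔ {a} {b} {c} = mk⇔ ⇒ ⇐
  where
  ⇒ : c ∈ range a b → a ≤ c × c < b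
  ⇒ c∈ with t , t<b∸a , refl ← ∈-applyUpTo⁻ (a +_) c∈ with a ≤? b
  ... | yes a≤b = m≤m+n a t , subst (a + t <_) (m+[n∸m]≡n a≤b) (+-monoʳ-< a t<b∸a)
  ... | no  a≰b = ⊥-elim (n≮0 (subst (t <_) (m≤n⇒m∸n≡0 (<⇒≤ (≰⇒> a≰b))) t<b∸a))
  ⇐ : a ≤ c × c < b → c ∈ range a b
  ⇐ (a≤c , c<b) = subst (_∈ range a b) (m+[n∸m]≡n a≤c) (∈-applyUpTo⁺ (a +_) (∸-monoˡ-< c<b a≤c))

∈-boxes⇔ : ∀ λ′ μ {a} → a ∈ boxes λ′ μ ⇔ SkewBox λ′ μ a
∈-boxes⇔ λ′ μ {a} = mk⇔ ⇒ ⇐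
  where
  rowBoxes : ℕ → List (ℕ × ℕ)
  rowBoxes i = map (i ,_) (range (row μ i) (row λ′ i))
  ⇒ : a ∈ boxes λ′ μ → SkewBox λ′ μ a
  ⇒ a∈ with ∈-concat⁻′ (map rowBoxes (upTo (length λ′))) a∈
  ... | _ , a∈row , row∈ with ∈-map⁻ rowBoxes row∈
  ... | i , _ , refl with ∈-map⁻ (i ,_) a∈row
  ... | c , c∈ , refl = to ∈-range⇔ c∈
  ⇐ : SkewBox λ′ μ a → a ∈ boxes λ′ μ
  ⇐ box@(_ , c<row) = ∈-concat⁺′ (∈-map⁺ (proj₁ a ,_) (from ∈-range⇔ box))
    (∈-map⁺ rowBoxes (∈-upTo⁺ (row>0⇒<length λ′ (≤-<-trans z≤n c<row))))

T-isStandard : ∀ λ′ μ F → T (isStandard λ′ μ F) ⇔ IsStandard λ′ μ F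
T-isStandard λ′ μ F = mk⇔ ⇒ ⇐
  where
  ordered : ℕ × ℕ → ℕ × ℕ → Bool
  ordered a b = if comparable a b then entry μ F a <ᵇ entry μ F b else true
  T-ordered : ∀ a b → T (ordered a b) ⇔ (a ◁ b → entry μ F a < entry μ F b)
  T-ordered a b = mk⇔ (λ t a◁b → <ᵇ⇒< _ _ (to T-implies t (from (T-comparable a b) a◁b)))
                      (λ f → from T-implies (<⇒<ᵇ ∘ f ∘ to (T-comparable a b)))
  T-allOrdered : ∀ a → T (allB (ordered a) (boxes λ′ μ)) ⇔ All (T ∘ ordered a) (boxes λ′ μ)
  T-allOrdered a = T-allB (boxes λ′ μ)
  ⇒ : T (isStandard λ′ μ F) → IsStandard λ′ μ F
  ⇒ t = let d , o = to T-∧ t in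
    to (T-distinct _) d ,
    λ {a} {b} a∈ b∈ → to (T-ordered a b)
      (All.lookup (to (T-allOrdered a) (All.lookup (to (T-allB (boxes λ′ μ)) o) (from (∈-boxes⇔ λ′ μ) a∈)))
        (from (∈-boxes⇔ λ′ μ) b∈))
  ⇐ : IsStandard λ′ μ F → T (isStandard λ′ μ F)
  ⇐ (u , inc) = from T-∧ (from (T-distinct _) u ,
    from (T-allB (boxes λ′ μ)) (All.tabulate λ {a} a∈ → from (T-allOrdered a) (All.tabulate λ {b} b∈ →
      from (T-ordered a b) (inc (to (∈-boxes⇔ λ′ μ) a∈) (to (∈-boxes⇔ λ′ μ) b∈)))))

concatMap≡cartesianProductWith : (f : A → B → Z) (xs : List A) (ys : List B) →
  concatMap (λ x → map (f x) ys) xs ≡ cartesianProductWith f xs ys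
concatMap≡cartesianProductWith f []       ys = refl
concatMap≡cartesianProductWith f (x ∷ xs) ys = cong (map (f x) ys ++_) (concatMap≡cartesianProductWith f xs ys)

module _ (xs : List A) (yss : List (List A)) where

  private
    consProduct : List (List A)
    consProduct = concatMap (λ x → map (x ∷_) yss) xs

    consProduct≡ : consProduct ≡ cartesianProductWith _∷_ xs yss
    consProduct≡ = concatMap≡cartesianProductWith _∷_ xs yss

  ∈-consProduct⁺ : ∀ {x ys} → x ∈ xs → ys ∈ yss → x ∷ ys ∈ consProduct
  ∈-consProduct⁺ x∈ ys∈ = subst (_ ∈_) (sym consProduct≡) (∈-cartesianProductWith⁺ _∷_ x∈ ys∈)

  ∈-consProduct⁻ : ∀ {zs} → zs ∈ consProduct → ∃₂ λ x ys → x ∈ xs × ys ∈ yss × zs ≡ x ∷ ys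
  ∈-consProduct⁻ {zs} zs∈ = ∈-cartesianProductWith⁻ _∷_ xs yss (subst (zs ∈_) consProduct≡ zs∈)

  Unique-consProduct : Unique xs → Unique yss → Unique consProduct
  Unique-consProduct uxs uyss =
    subst Unique (sym consProduct≡) (Unique.cartesianProductWith⁺ _∷_ ∷-injective uxs uyss)

∈-listsOf⁻ : ∀ m {xs r} → r ∈ listsOf m xs → length r ≡ m × All (_∈ xs) r
∈-listsOf⁻ zero    (here refl) = refl , []
∈-listsOf⁻ (suc m) {xs} r∈ with x , r′ , x∈ , r′∈ , refl ← ∈-consProduct⁻ xs (listsOf m xs) r∈ =
  let ℓ , r′⊆ = ∈-listsOf⁻ m r′∈ in cong suc ℓ , x∈ ∷ r′⊆

∈-listsOf⁺ : ∀ {xs r} → All (_∈ xs) r → r ∈ listsOf (length r) xs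
∈-listsOf⁺ []        = here refl
∈-listsOf⁺ {xs} (x∈ ∷ r⊆) = ∈-consProduct⁺ xs _ x∈ (∈-listsOf⁺ r⊆)

Unique-listsOf : ∀ m {xs} → Unique xs → Unique (listsOf m xs)
Unique-listsOf zero    u = [] ∷ []
Unique-listsOf (suc m) {xs} u = Unique-consProduct xs (listsOf m xs) u (Unique-listsOf m u)

RowLengths : List ℕ → Filling → Set
RowLengths ms F = length F ≡ length ms × (∀ i → length (getR F i) ≡ getL ms i)

∈-productRows⁻ : ∀ ms {xs F} → F ∈ productRows ms xs → RowLengths ms F × All (_∈ xs) (concat F)
∈-productRows⁻ []       (here refl) = (refl , λ { zero → refl ; (suc i) → refl }) , []
∈-productRows⁻ (m ∷ ms) {xs} F∈
  with r , F′ , r∈ , F′∈ , refl ← ∈-consProduct⁻ (listsOf m xs) (productRows ms xs) F∈ =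
  let ℓr , r⊆ = ∈-listsOf⁻ m r∈ ; (ℓ , ℓs) , F′⊆ = ∈-productRows⁻ ms F′∈ in
  (cong suc ℓ , λ { zero → ℓr ; (suc i) → ℓs i }) , All.++⁺ r⊆ F′⊆

∈-productRows⁺ : ∀ ms {xs F} → RowLengths ms F → All (_∈ xs) (concat F) → F ∈ productRows ms xs
∈-productRows⁺ []       {F = []}         _        _     = here refl
∈-productRows⁺ (m ∷ ms) {xs} {r ∷ F} (ℓ , ℓs) r∷F⊆ =
  let r⊆ , F⊆ = All.++⁻ r r∷F⊆ in
  ∈-consProduct⁺ (listsOf m xs) (productRows ms xs) (subst (λ k → r ∈ listsOf k xs) (ℓs 0) (∈-listsOf⁺ r⊆))
                 (∈-productRows⁺ ms (suc-injective ℓ , ℓs ∘ suc) F⊆)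

Unique-productRows : ∀ ms {xs} → Unique xs → Unique (productRows ms xs)
Unique-productRows []       u = [] ∷ []
Unique-productRows (m ∷ ms) {xs} u =
  Unique-consProduct (listsOf m xs) (productRows ms xs) (Unique-listsOf m u) (Unique-productRows ms u)

record HasShape (λ′ μ : List ℕ) (F : Filling) : Set where
  constructor mkShape
  field
    rowCount  : length F ≡ length λ′
    rowLength : ∀ i → length (getR F i) ≡ row λ′ i ∸ row μ i

open HasShape

EntriesIn : ℕ → Filling → Set
EntriesIn K F = All (λ x → 0 < x × x ≤ K) (concat F)

∈-applyUpTo-suc⇔ : ∀ {K x} → x ∈ applyUpTo suc K ⇔ (0 < x × x ≤ K)
∈-applyUpTo-suc⇔ = mk⇔ (λ x∈ → case ∈-applyUpTo⁻ suc x∈ of λ { (_ , i<K , refl) → s≤s z≤n , i<K })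
                        (λ { (s≤s z≤n , x≤K) → ∈-applyUpTo⁺ suc x≤K })

getL-map-applyUpTo : ∀ (f g : ℕ → ℕ) n {i} → (n ≤ i → f (g i) ≡ 0) → getL (map f (applyUpTo g n)) i ≡ f (g i)
getL-map-applyUpTo f g zero    beyond = sym (beyond z≤n)
getL-map-applyUpTo f g (suc n) {zero}  beyond = refl
getL-map-applyUpTo f g (suc n) {suc i} beyond = getL-map-applyUpTo f (g ∘ suc) n (beyond ∘ s≤s)

∈-candidates⇔ : ∀ λ′ μ K {F} → F ∈ candidates λ′ μ K ⇔ (HasShape λ′ μ F × EntriesIn K F)
∈-candidates⇔ λ′ μ K {F} = mk⇔ ⇒ ⇐
  where
  skewRow : ℕ → ℕ
  skewRow i = row λ′ i ∸ row μ i
  rowLengths = map skewRow (upTo (length λ′))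
  getL-rowLengths : ∀ i → getL rowLengths i ≡ skewRow i
  getL-rowLengths i = getL-map-applyUpTo skewRow id (length λ′)
    (λ ℓ≤i → trans (cong (_∸ row μ i) (row-beyond λ′ ℓ≤i)) (0∸n≡0 (row μ i)))
  length-rowLengths : length rowLengths ≡ length λ′
  length-rowLengths = trans (length-map skewRow (upTo (length λ′))) (length-upTo (length λ′))
  ⇒ : F ∈ candidates λ′ μ K → HasShape λ′ μ F × EntriesIn K F
  ⇒ F∈ = let (ℓ , ℓs) , F⊆ = ∈-productRows⁻ rowLengths F∈ in
    mkShape (trans ℓ length-rowLengths) (λ i → trans (ℓs i) (getL-rowLengths i)) , All.map (to ∈-applyUpTo-suc⇔) F⊆
  ⇐ : HasShape λ′ μ F × EntriesIn K F → F ∈ candidates λ′ μ K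
  ⇐ (mkShape ℓ ℓs , bounded) = ∈-productRows⁺ rowLengths
    (trans ℓ (sym length-rowLengths) , λ i → trans (ℓs i) (sym (getL-rowLengths i)))
    (All.map (from ∈-applyUpTo-suc⇔) bounded)

Unique-candidates : ∀ λ′ μ K → Unique (candidates λ′ μ K)
Unique-candidates λ′ μ K = Unique-productRows (map (λ i → row λ′ i ∸ row μ i) (upTo (length λ′)))
  (Unique.applyUpTo⁺₁ suc K (λ i<j _ → <⇒≢ i<j ∘ suc-injective))

-- Young diagrams and paths in Young's lattice

-- Unlike IsPartition, zero rows are allowed, so that removing a box stays inside the class.
IsDiagram : List ℕ → Set
IsDiagram ν = ∀ i → row ν (suc i) ≤ row ν i

IsPartition⇒IsDiagram : ∀ {ν} → IsPartition ν → IsDiagram ν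
IsPartition⇒IsDiagram {[]}             _            i       = z≤n
IsPartition⇒IsDiagram {_ ∷ []}         _            i       = z≤n
IsPartition⇒IsDiagram {_ ∷ _ ∷ _}      (x≥y ∷ _ , _) zero    = x≥y
IsPartition⇒IsDiagram {_ ∷ ν@(_ ∷ _)} (_ ∷ ν↓ , _ ∷ ν>0) (suc i) = IsPartition⇒IsDiagram {ν} (ν↓ , ν>0) i

row-drop1 : ∀ ν i → row (drop 1 ν) i ≡ row ν (suc i)
row-drop1 []      i = refl
row-drop1 (_ ∷ ν) i = refl

IsDiagram-drop1 : ∀ {ν} → IsDiagram ν → IsDiagram (drop 1 ν)
IsDiagram-drop1 {[]}    _  i = z≤n
IsDiagram-drop1 {_ ∷ ν} ν↓ i = ν↓ (suc i)

IsDiagram-mono : ∀ ν → IsDiagram ν → ∀ {i j} → i ≤ j → row ν j ≤ row ν i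
IsDiagram-mono ν ν↓ {i} i≤j with o , refl ← m≤n⇒∃[o]m+o≡n i≤j = go o
  where
  go : ∀ o → row ν (i + o) ≤ row ν i
  go zero    = ≤-reflexive (cong (row ν) (+-identityʳ i))
  go (suc o) = subst (λ k → row ν k ≤ row ν i) (sym (+-suc i o)) (≤-trans (ν↓ (i + o)) (go o))

size-∷ : ∀ ν → size ν ≡ row ν 0 + size (drop 1 ν)
size-∷ []      = refl
size-∷ (_ ∷ ν) = refl

⊆ᴾ-drop1 : ∀ μ ν → μ ⊆ᴾ ν → drop 1 μ ⊆ᴾ drop 1 ν
⊆ᴾ-drop1 μ ν μ⊆ν i = subst₂ _≤_ (sym (row-drop1 μ i)) (sym (row-drop1 ν i)) (μ⊆ν (suc i))

size-mono : ∀ μ ν → μ ⊆ᴾ ν → size μ ≤ size ν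
size-mono []      ν μ⊆ν = z≤n
size-mono (b ∷ μ) ν μ⊆ν = subst (b + size μ ≤_) (sym (size-∷ ν))
  (+-mono-≤ (μ⊆ν 0) (size-mono μ (drop 1 ν) (⊆ᴾ-drop1 (b ∷ μ) ν μ⊆ν)))

size-mono-< : ∀ μ ν {i} → μ ⊆ᴾ ν → row μ i < row ν i → size μ < size ν
size-mono-< μ ν {i} μ⊆ν μᵢ<νᵢ = subst₂ _<_ (sym (size-∷ μ)) (sym (size-∷ ν)) (go i μᵢ<νᵢ)
  where
  rest≤ = size-mono (drop 1 μ) (drop 1 ν) (⊆ᴾ-drop1 μ ν μ⊆ν)
  go : ∀ i → row μ i < row ν i → row μ 0 + size (drop 1 μ) < row ν 0 + size (drop 1 ν)
  go zero    μ₀<ν₀ = +-mono-<-≤ μ₀<ν₀ rest≤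
  go (suc i) μᵢ<νᵢ = +-mono-≤-< (μ⊆ν 0)
    (size-mono-< (drop 1 μ) (drop 1 ν) (⊆ᴾ-drop1 μ ν μ⊆ν)
      (subst₂ _<_ (sym (row-drop1 μ i)) (sym (row-drop1 ν i)) μᵢ<νᵢ))

removeBox : List ℕ → ℕ → List ℕ
removeBox []      i       = []
removeBox (a ∷ ν) zero    = pred a ∷ ν
removeBox (a ∷ ν) (suc i) = a ∷ removeBox ν i

row-removeBox-≡ : ∀ ν i → row (removeBox ν i) i ≡ pred (row ν i)
row-removeBox-≡ []      i       = refl
row-removeBox-≡ (a ∷ ν) zero    = refl
row-removeBox-≡ (a ∷ ν) (suc i) = row-removeBox-≡ ν i

row-removeBox-≢ : ∀ ν {i j} → j ≢ i → row (removeBox ν i) j ≡ row ν j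
row-removeBox-≢ []      j≢i = refl
row-removeBox-≢ (a ∷ ν) {zero}  {zero}  j≢i = ⊥-elim (j≢i refl)
row-removeBox-≢ (a ∷ ν) {zero}  {suc j} j≢i = refl
row-removeBox-≢ (a ∷ ν) {suc i} {zero}  j≢i = refl
row-removeBox-≢ (a ∷ ν) {suc i} {suc j} j≢i = row-removeBox-≢ ν (j≢i ∘ cong suc)

length-removeBox : ∀ ν i → length (removeBox ν i) ≡ length ν
length-removeBox []      i       = refl
length-removeBox (a ∷ ν) zero    = refl
length-removeBox (a ∷ ν) (suc i) = cong suc (length-removeBox ν i)

size-removeBox : ∀ ν i → 0 < row ν i → suc (size (removeBox ν i)) ≡ size ν
size-removeBox (suc a ∷ ν) zero    _   = refl
size-removeBox (a ∷ ν)     (suc i) a>0 = trans (sym (+-suc a _)) (cong (a +_) (size-removeBox ν i a>0))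

row-removeBox-≤ : ∀ ν i j → row (removeBox ν i) j ≤ row ν j
row-removeBox-≤ ν i j with j ≟ i
... | yes refl = subst (_≤ row ν j) (sym (row-removeBox-≡ ν j)) (pred[n]≤n)
... | no  j≢i  = ≤-reflexive (row-removeBox-≢ ν j≢i)

IsDiagram-removeBox : ∀ ν i → IsDiagram ν → row ν (suc i) < row ν i → IsDiagram (removeBox ν i)
IsDiagram-removeBox ν i ν↓ i-corner j with j ≟ i | suc j ≟ i
... | yes refl | _        = subst₂ _≤_ (sym (row-removeBox-≢ ν 1+n≢n)) (sym (row-removeBox-≡ ν j)) (<⇒≤pred i-corner)
... | no  j≢i  | yes refl = subst₂ _≤_ (sym (row-removeBox-≡ ν (suc j))) (sym (row-removeBox-≢ ν j≢i))
                              (≤-trans pred[n]≤n (ν↓ j))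
... | no  j≢i  | no sj≢i  = subst₂ _≤_ (sym (row-removeBox-≢ ν sj≢i)) (sym (row-removeBox-≢ ν j≢i)) (ν↓ j)

⊆ᴾ-removeBox : ∀ ν μ i → μ ⊆ᴾ ν → row μ i < row ν i → μ ⊆ᴾ removeBox ν i
⊆ᴾ-removeBox ν μ i μ⊆ν μᵢ<νᵢ j with j ≟ i
... | yes refl = subst (row μ j ≤_) (sym (row-removeBox-≡ ν j)) (<⇒≤pred μᵢ<νᵢ)
... | no  j≢i  = subst (row μ j ≤_) (sym (row-removeBox-≢ ν j≢i)) (μ⊆ν j)

IsCorner : List ℕ → List ℕ → ℕ → Set
IsCorner ν μ i = row μ i < row ν i × row ν (suc i) < row ν i

corners : List ℕ → List ℕ → List ℕ
corners []      μ = []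
corners (a ∷ ν) μ = (if (row μ 0 <ᵇ a) ∧ (row ν 0 <ᵇ a) then 0 ∷ [] else []) ++ map suc (corners ν (drop 1 μ))

∈-corners⇔ : ∀ ν μ {i} → i ∈ corners ν μ ⇔ IsCorner ν μ i
∈-corners⇔ []      μ = mk⇔ (λ ()) (λ { (() , _) })
∈-corners⇔ (a ∷ ν) μ = mk⇔ ⇒ ⇐
  where
  topCorner? = (row μ 0 <ᵇ a) ∧ (row ν 0 <ᵇ a)
  ⇒ : ∀ {i} → i ∈ corners (a ∷ ν) μ → IsCorner (a ∷ ν) μ i
  ⇒ i∈ with topCorner? in eq | ∈-++⁻ (if topCorner? then 0 ∷ [] else []) i∈
  ... | true  | inj₁ (here refl) = let μ<a , ν<a = to T-∧ (subst T (sym eq) tt) in <ᵇ⇒< _ _ μ<a , <ᵇ⇒< _ _ ν<a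
  ... | _     | inj₂ i∈′ with i′ , i′∈ , refl ← ∈-map⁻ suc i∈′ =
    let μ<ν , corner = to (∈-corners⇔ ν (drop 1 μ)) i′∈ in subst (_< row ν i′) (row-drop1 μ i′) μ<ν , corner
  ⇐ : ∀ {i} → IsCorner (a ∷ ν) μ i → i ∈ corners (a ∷ ν) μ
  ⇐ {zero}   (μ<a , ν<a) rewrite to T-≡ (<⇒<ᵇ μ<a) | to T-≡ (<⇒<ᵇ ν<a) = here refl
  ⇐ {suc i′} (μ<a , ν<a) = ∈-++⁺ʳ (if topCorner? then 0 ∷ [] else [])
    (∈-map⁺ suc (from (∈-corners⇔ ν (drop 1 μ)) (subst (_< row ν i′) (sym (row-drop1 μ i′)) μ<a , ν<a)))

Unique-corners : ∀ ν μ → Unique (corners ν μ)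
Unique-corners []      μ = []
Unique-corners (a ∷ ν) μ with (row μ 0 <ᵇ a) ∧ (row ν 0 <ᵇ a)
... | true  = All.map⁺ (All.universal (λ _ ()) _) ∷ Unique.map⁺ suc-injective (Unique-corners ν (drop 1 μ))
... | false = Unique.map⁺ suc-injective (Unique-corners ν (drop 1 μ))

corners-⊆ : ∀ ν μ → corners ν μ ⊆ corners ν []
corners-⊆ []          μ = []
corners-⊆ (zero ∷ ν)  μ = Sublist.map⁺ suc (corners-⊆ ν (drop 1 μ))
corners-⊆ (suc a ∷ ν) μ = Sublist.++⁺ top (Sublist.map⁺ suc (corners-⊆ ν (drop 1 μ)))
  where
  top : (if (row μ 0 <ᵇ suc a) ∧ (row ν 0 <ᵇ suc a) then 0 ∷ [] else []) ⊆
        (if row ν 0 <ᵇ suc a then 0 ∷ [] else [])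
  top with row μ 0 <ᵇ suc a
  ... | false = minimum _
  ... | true  = ⊆-refl

paths : ℕ → List ℕ → List ℕ → ℕ
paths zero    ν μ = 1
paths (suc K) ν μ = sum (map (λ i → paths K (removeBox ν i) μ) (corners ν μ))

-- Lists that differ by trailing zeros describe the same diagram.
SameRows : List ℕ → List ℕ → Set
SameRows ν ν′ = ∀ i → row ν i ≡ row ν′ i

SameRows-drop1 : ∀ ν ν′ → SameRows ν ν′ → SameRows (drop 1 ν) (drop 1 ν′)
SameRows-drop1 ν ν′ same i = trans (row-drop1 ν i) (trans (same (suc i)) (sym (row-drop1 ν′ i)))

SameRows-removeBox : ∀ ν ν′ i → SameRows ν ν′ → SameRows (removeBox ν i) (removeBox ν′ i)
SameRows-removeBox ν ν′ i same j with j ≟ i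
... | yes refl = trans (row-removeBox-≡ ν j) (trans (cong pred (same j)) (sym (row-removeBox-≡ ν′ j)))
... | no  j≢i  = trans (row-removeBox-≢ ν j≢i) (trans (same j) (sym (row-removeBox-≢ ν′ j≢i)))

size≡⇒SameRows : ∀ μ ν → μ ⊆ᴾ ν → size ν ≡ size μ → SameRows ν μ
size≡⇒SameRows μ ν μ⊆ν sizes i with row μ i <? row ν i
... | yes μᵢ<νᵢ = ⊥-elim (<-irrefl (sym sizes) (size-mono-< μ ν μ⊆ν μᵢ<νᵢ))
... | no  μᵢ≮νᵢ = ≤-antisym (≮⇒≥ μᵢ≮νᵢ) (μ⊆ν i)

corners-empty : ∀ ν μ → (∀ i → row ν i ≡ 0) → corners ν μ ≡ []
corners-empty ν μ ν≡0 = ∀∉⇒≡[] λ {i} i∈ → n≮0 (subst (row μ i <_) (ν≡0 i) (proj₁ (to (∈-corners⇔ ν μ) i∈)))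

corners-full : ∀ ν μ → μ ⊆ᴾ ν → size ν ≡ size μ → corners ν μ ≡ []
corners-full ν μ μ⊆ν sizes =
  ∀∉⇒≡[] λ i∈ → <-irrefl (sym sizes) (size-mono-< μ ν μ⊆ν (proj₁ (to (∈-corners⇔ ν μ) i∈)))

corners-cong : ∀ ν ν′ μ μ′ → SameRows ν ν′ → SameRows μ μ′ → corners ν μ ≡ corners ν′ μ′
corners-cong []        []        μ μ′ same _ = refl
corners-cong []        ν′@(_ ∷ _) μ μ′ same _ = sym (corners-empty ν′ μ′ (sym ∘ same))
corners-cong ν@(_ ∷ _) []        μ μ′ same _ = corners-empty ν μ same
corners-cong (a ∷ ν) (a′ ∷ ν′) μ μ′ same sameμ with refl ← same 0 =
  cong₂ _++_ (cong (λ b → if b then 0 ∷ [] else [])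
                   (cong₂ _∧_ (cong (_<ᵇ a) (sameμ 0)) (cong (_<ᵇ a) (same 1))))
             (cong (map suc) (corners-cong ν ν′ (drop 1 μ) (drop 1 μ′) (same ∘ suc) (SameRows-drop1 μ μ′ sameμ)))

paths-cong : ∀ K ν ν′ μ μ′ → SameRows ν ν′ → SameRows μ μ′ → paths K ν μ ≡ paths K ν′ μ′
paths-cong zero    ν ν′ μ μ′ same sameμ = refl
paths-cong (suc K) ν ν′ μ μ′ same sameμ =
  cong sum (trans (map-cong (λ i → paths-cong K _ _ μ μ′ (SameRows-removeBox ν ν′ i same) sameμ) (corners ν μ))
                  (cong (map λ i → paths K (removeBox ν′ i) μ′) (corners-cong ν ν′ μ μ′ same sameμ)))

removeCorner : ∀ λ′ μ {K i} → IsDiagram λ′ → μ ⊆ᴾ λ′ → size λ′ ≡ size μ + suc K → IsCorner λ′ μ i →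
  IsDiagram (removeBox λ′ i) × μ ⊆ᴾ removeBox λ′ i × size (removeBox λ′ i) ≡ size μ + K
removeCorner λ′ μ {K} {i} λ↓ μ⊆λ sizes (μᵢ<λᵢ , shorterBelow) =
  IsDiagram-removeBox λ′ i λ↓ shorterBelow , ⊆ᴾ-removeBox λ′ μ i μ⊆λ μᵢ<λᵢ ,
  suc-injective (trans (size-removeBox λ′ i (≤-<-trans z≤n μᵢ<λᵢ)) (trans sizes (+-suc (size μ) K)))

IsCorner-∷ : ∀ a ν μ {i} → IsCorner ν (drop 1 μ) i → IsCorner (a ∷ ν) μ (suc i)
IsCorner-∷ a ν μ {i} (μᵢ<νᵢ , shorterBelow) = subst (_< row ν i) (row-drop1 μ i) μᵢ<νᵢ , shorterBelow

-- Appending and removing the largest entry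

updateRow : ℕ → (List ℕ → List ℕ) → Filling → Filling
updateRow i       f []      = []
updateRow zero    f (r ∷ F) = f r ∷ F
updateRow (suc i) f (r ∷ F) = r ∷ updateRow i f F

length-updateRow : ∀ i f F → length (updateRow i f F) ≡ length F
length-updateRow i       f []      = refl
length-updateRow zero    f (r ∷ F) = refl
length-updateRow (suc i) f (r ∷ F) = cong suc (length-updateRow i f F)

getR-updateRow-≡ : ∀ i f F → i < length F → getR (updateRow i f F) i ≡ f (getR F i)
getR-updateRow-≡ zero    f (r ∷ F) _         = refl
getR-updateRow-≡ (suc i) f (r ∷ F) (s≤s i<ℓ) = getR-updateRow-≡ i f F i<ℓ

getR-updateRow-≢ : ∀ i f F {j} → j ≢ i → getR (updateRow i f F) j ≡ getR F j
getR-updateRow-≢ i       f []      j≢i = refl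
getR-updateRow-≢ zero    f (r ∷ F) {zero}  j≢i = ⊥-elim (j≢i refl)
getR-updateRow-≢ zero    f (r ∷ F) {suc j} j≢i = refl
getR-updateRow-≢ (suc i) f (r ∷ F) {zero}  j≢i = refl
getR-updateRow-≢ (suc i) f (r ∷ F) {suc j} j≢i = getR-updateRow-≢ i f F (j≢i ∘ cong suc)

updateRow-∘ : ∀ i f g F → updateRow i f (updateRow i g F) ≡ updateRow i (f ∘ g) F
updateRow-∘ i       f g []      = refl
updateRow-∘ zero    f g (r ∷ F) = refl
updateRow-∘ (suc i) f g (r ∷ F) = cong (r ∷_) (updateRow-∘ i f g F)

updateRow-id : ∀ i f F → f (getR F i) ≡ getR F i → updateRow i f F ≡ F
updateRow-id i       f []      _  = refl
updateRow-id zero    f (r ∷ F) fr≡r = cong (_∷ F) fr≡r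
updateRow-id (suc i) f (r ∷ F) fr≡r = cong (r ∷_) (updateRow-id i f F fr≡r)

appendAt : ℕ → ℕ → Filling → Filling
appendAt i v = updateRow i (_++ v ∷ [])

dropLast : List ℕ → List ℕ
dropLast []          = []
dropLast (x ∷ [])    = []
dropLast (x ∷ y ∷ r) = x ∷ dropLast (y ∷ r)

removeLastAt : ℕ → Filling → Filling
removeLastAt i = updateRow i dropLast

dropLast-++-[x] : ∀ r {v} → dropLast (r ++ v ∷ []) ≡ r
dropLast-++-[x] []          = refl
dropLast-++-[x] (x ∷ [])    = refl
dropLast-++-[x] (x ∷ y ∷ r) = cong (x ∷_) (dropLast-++-[x] (y ∷ r))

dropLast-++-last : ∀ r {m v} → length r ≡ suc m → getL r m ≡ v → dropLast r ++ v ∷ [] ≡ r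
dropLast-++-last (x ∷ [])    {zero}  refl refl = refl
dropLast-++-last (x ∷ y ∷ r) {suc m} ℓ    last = cong (x ∷_) (dropLast-++-last (y ∷ r) (suc-injective ℓ) last)

removeLastAt-appendAt : ∀ i v F → removeLastAt i (appendAt i v F) ≡ F
removeLastAt-appendAt i v F =
  trans (updateRow-∘ i dropLast (_++ v ∷ []) F) (updateRow-id i _ F (dropLast-++-[x] (getR F i)))

appendAt-removeLastAt : ∀ i v F → dropLast (getR F i) ++ v ∷ [] ≡ getR F i →
  appendAt i v (removeLastAt i F) ≡ F
appendAt-removeLastAt i v F last = trans (updateRow-∘ i (_++ v ∷ []) dropLast F) (updateRow-id i _ F last)

rowOf : ℕ → Filling → ℕ
rowOf v []      = 0
rowOf v (r ∷ F) = if elem v r then 0 else suc (rowOf v F)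

rowOf-appendAt : ∀ i v F → v ∉ concat F → i < length F → rowOf v (appendAt i v F) ≡ i
rowOf-appendAt zero    v (r ∷ F) v∉ _ rewrite to T-≡ (from (T-elem (r ++ v ∷ [])) (∈-++⁺ʳ r (here refl))) = refl
rowOf-appendAt (suc i) v (r ∷ F) v∉ (s≤s i<ℓ) with elem v r in eq
... | true  = ⊥-elim (v∉ (∈-++⁺ˡ (to (T-elem r) (subst T (sym eq) tt))))
... | false = cong suc (rowOf-appendAt i v F (v∉ ∘ ∈-++⁺ʳ r) i<ℓ)

concat-appendAt-↭ : ∀ i v F → i < length F → concat (appendAt i v F) ↭ v ∷ concat F
concat-appendAt-↭ zero    v (r ∷ F) _         =
  ↭-trans (↭-reflexive (++-assoc r (v ∷ []) (concat F))) (↭.shift v r (concat F))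
concat-appendAt-↭ (suc i) v (r ∷ F) (s≤s i<ℓ) =
  ↭-trans (↭.++⁺ˡ r (concat-appendAt-↭ i v F i<ℓ)) (↭.shift v r (concat F))

Unique-∷⇔ : ∀ {v : ℕ} {xs} → Unique (v ∷ xs) ⇔ (v ∉ xs × Unique xs)
Unique-∷⇔ {xs = xs} = mk⇔ (λ { u@(_ ∷ uxs) → Unique.Unique[x∷xs]⇒x∉xs u , uxs })
                          (λ (v∉ , uxs) → All.¬Any⇒All¬ xs v∉ ∷ uxs)

Unique-appendAt⇔ : ∀ i v F → i < length F →
  Unique (concat (appendAt i v F)) ⇔ (v ∉ concat F × Unique (concat F))
Unique-appendAt⇔ i v F i<ℓ = mk⇔
  (to Unique-∷⇔ ∘ Unique-resp-↭ (↭⇒↭ₛ (concat-appendAt-↭ i v F i<ℓ)))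
  (Unique-resp-↭ (↭⇒↭ₛ (↭-sym (concat-appendAt-↭ i v F i<ℓ))) ∘ from Unique-∷⇔)

EntriesIn-appendAt : ∀ i K F → i < length F → EntriesIn K F → EntriesIn (suc K) (appendAt i (suc K) F)
EntriesIn-appendAt i K F i<ℓ bounded = ↭.All-resp-↭ (↭-sym (concat-appendAt-↭ i (suc K) F i<ℓ))
  ((s≤s z≤n , ≤-refl) ∷ All.map (λ (x>0 , x≤K) → x>0 , ≤-trans x≤K (n≤1+n K)) bounded)

EntriesIn-removed : ∀ i K F → i < length F → EntriesIn (suc K) (appendAt i (suc K) F) →
  suc K ∉ concat F → EntriesIn K F
EntriesIn-removed i K F i<ℓ bounded v∉ with ↭.All-resp-↭ (concat-appendAt-↭ i (suc K) F i<ℓ) bounded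
... | _ ∷ boundedF = All.tabulate λ x∈ → let x>0 , x≤v = All.lookup boundedF x∈ in
  x>0 , ≤-pred (≤∧≢⇒< x≤v λ { refl → v∉ x∈ })

getL-++ˡ : ∀ r s {m} → m < length r → getL (r ++ s) m ≡ getL r m
getL-++ˡ (x ∷ r) s {zero}  _         = refl
getL-++ˡ (x ∷ r) s {suc m} (s≤s m<ℓ) = getL-++ˡ r s m<ℓ

getL-++-length : ∀ r {v s} → getL (r ++ v ∷ s) (length r) ≡ v
getL-++-length []      = refl
getL-++-length (x ∷ r) = getL-++-length r

SkewBox-removeBox : ∀ λ′ μ i {a} → SkewBox (removeBox λ′ i) μ a → SkewBox λ′ μ a
SkewBox-removeBox λ′ μ i {j , c} (μ≤c , c<) = μ≤c , <-≤-trans c< (row-removeBox-≤ λ′ i j)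

SkewBox-split : ∀ λ′ μ i {j c} → SkewBox λ′ μ (j , c) →
  SkewBox (removeBox λ′ i) μ (j , c) ⊎ (j ≡ i × c ≡ pred (row λ′ i))
SkewBox-split λ′ μ i {j} {c} (μ≤c , c<λ) with j ≟ i
... | no  j≢i  = inj₁ (μ≤c , subst (c <_) (sym (row-removeBox-≢ λ′ j≢i)) c<λ)
... | yes refl with c <? pred (row λ′ j)
...   | yes c<  = inj₁ (μ≤c , subst (c <_) (sym (row-removeBox-≡ λ′ j)) c<)
...   | no  c≮  = inj₂ (refl , ≤-antisym (<⇒≤pred c<λ) (≮⇒≥ c≮))

module _ {λ′ μ F i} (shape : HasShape (removeBox λ′ i) μ F) where

  entry-appendAt-old : ∀ {v j c} → SkewBox (removeBox λ′ i) μ (j , c) →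
    entry μ (appendAt i v F) (j , c) ≡ entry μ F (j , c)
  entry-appendAt-old {v} {j} {c} (μ≤c , c<) with j ≟ i
  ... | no  j≢i  = cong (λ r → getL r (c ∸ row μ j)) (getR-updateRow-≢ i (_++ v ∷ []) F j≢i)
  ... | yes refl = trans (cong (λ r → getL r (c ∸ row μ j)) (getR-updateRow-≡ j (_++ v ∷ []) F j<ℓ))
                         (getL-++ˡ (getR F j) (v ∷ [])
                           (subst (c ∸ row μ j <_) (sym (rowLength shape j)) (∸-monoˡ-< c< μ≤c)))
    where
    j<ℓ : j < length F
    j<ℓ = subst (j <_) (sym (rowCount shape)) (row>0⇒<length (removeBox λ′ j) (≤-<-trans z≤n c<))

  entry-appendAt-new : ∀ {v} → i < length F → entry μ (appendAt i v F) (i , row (removeBox λ′ i) i) ≡ v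
  entry-appendAt-new {v} i<ℓ =
    trans (cong (λ r → getL r (row (removeBox λ′ i) i ∸ row μ i)) (getR-updateRow-≡ i (_++ v ∷ []) F i<ℓ))
          (subst (λ m → getL (getR F i ++ v ∷ []) m ≡ v) (rowLength shape i) (getL-++-length (getR F i)))

length-++-[x] : ∀ (r : List ℕ) {v} → length (r ++ v ∷ []) ≡ suc (length r)
length-++-[x] r = trans (length-++ r) (+-comm (length r) 1)

suc[pred[m]∸n]≡m∸n : ∀ {m n} → n < m → suc (pred m ∸ n) ≡ m ∸ n
suc[pred[m]∸n]≡m∸n {suc m} n<m = sym (+-∸-assoc 1 (≤-pred n<m))

HasShape-appendAt⇔ : ∀ λ′ μ i v F → row μ i < row λ′ i → i < length F →
  HasShape (removeBox λ′ i) μ F ⇔ HasShape λ′ μ (appendAt i v F)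
HasShape-appendAt⇔ λ′ μ i v F μᵢ<λᵢ i<ℓ = mk⇔
  (λ (mkShape ℓ ℓs) → mkShape (trans (length-updateRow i _ F) (trans ℓ (length-removeBox λ′ i))) (⇒rows ℓs))
  (λ (mkShape ℓ ℓs) →
     mkShape (trans (sym (length-updateRow i _ F)) (trans ℓ (sym (length-removeBox λ′ i)))) (⇐rows ℓs))
  where
  newRow : length (getR (appendAt i v F) i) ≡ suc (length (getR F i))
  newRow = trans (cong length (getR-updateRow-≡ i _ F i<ℓ)) (length-++-[x] (getR F i))
  removedRow : row λ′ i ∸ row μ i ≡ suc (row (removeBox λ′ i) i ∸ row μ i)
  removedRow = trans (sym (suc[pred[m]∸n]≡m∸n μᵢ<λᵢ)) (cong (λ k → suc (k ∸ row μ i)) (sym (row-removeBox-≡ λ′ i)))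
  otherRow : ∀ {j} → j ≢ i →
    length (getR (appendAt i v F) j) ≡ length (getR F j) × row (removeBox λ′ i) j ≡ row λ′ j
  otherRow j≢i = cong length (getR-updateRow-≢ i _ F j≢i) , row-removeBox-≢ λ′ j≢i
  ⇒rows : (∀ j → length (getR F j) ≡ row (removeBox λ′ i) j ∸ row μ j) →
          (∀ j → length (getR (appendAt i v F) j) ≡ row λ′ j ∸ row μ j)
  ⇒rows ℓs j with j ≟ i
  ... | yes refl = trans newRow (trans (cong suc (ℓs j)) (sym removedRow))
  ... | no  j≢i  = let ℓ≡ , row≡ = otherRow j≢i in trans ℓ≡ (trans (ℓs j) (cong (_∸ row μ j) row≡))
  ⇐rows : (∀ j → length (getR (appendAt i v F) j) ≡ row λ′ j ∸ row μ j) →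
          (∀ j → length (getR F j) ≡ row (removeBox λ′ i) j ∸ row μ j)
  ⇐rows ℓs j with j ≟ i
  ... | yes refl = suc-injective (trans (sym newRow) (trans (ℓs j) removedRow))
  ... | no  j≢i  = let ℓ≡ , row≡ = otherRow j≢i in trans (sym ℓ≡) (trans (ℓs j) (cong (_∸ row μ j) (sym row≡)))

getL-∈ : ∀ r {m} → m < length r → getL r m ∈ r
getL-∈ (x ∷ r) {zero}  _         = here refl
getL-∈ (x ∷ r) {suc m} (s≤s m<ℓ) = there (getL-∈ r m<ℓ)

getR-⊆-concat : ∀ F i {x} → x ∈ getR F i → x ∈ concat F
getR-⊆-concat (r ∷ F) zero    x∈ = ∈-++⁺ˡ x∈
getR-⊆-concat (r ∷ F) (suc i) x∈ = ∈-++⁺ʳ r (getR-⊆-concat F i x∈)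

entry-∈-concat : ∀ {λ′ μ F a} → HasShape λ′ μ F → SkewBox λ′ μ a → entry μ F a ∈ concat F
entry-∈-concat {λ′} {μ} {F} {i , c} (mkShape _ ℓs) (μ≤c , c<λ) =
  getR-⊆-concat F i (getL-∈ (getR F i) (subst (c ∸ row μ i <_) (sym (ℓs i)) (∸-monoˡ-< c<λ μ≤c)))

corner<length : ∀ {λ′ μ i F} → IsCorner λ′ μ i → HasShape (removeBox λ′ i) μ F → i < length F
corner<length {λ′} {i = i} (μᵢ<λᵢ , _) shape =
  subst (i <_) (sym (trans (rowCount shape) (length-removeBox λ′ i))) (row>0⇒<length λ′ (≤-<-trans z≤n μᵢ<λᵢ))

EntriesIn⇒suc∉ : ∀ {K} F → EntriesIn K F → suc K ∉ concat F
EntriesIn⇒suc∉ F bounded v∈ = 1+n≰n (proj₂ (All.lookup bounded v∈))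

module _ {λ′ μ i K F} (λ↓ : IsDiagram λ′) (corner : IsCorner λ′ μ i)
         (shape : HasShape (removeBox λ′ i) μ F) (bounded : EntriesIn K F) where

  private
    v = suc K
    newColumn = pred (row λ′ i)

    i<ℓ : i < length F
    i<ℓ = corner<length corner shape

    v∉F : v ∉ concat F
    v∉F = EntriesIn⇒suc∉ F bounded

    entry-new : entry μ (appendAt i v F) (i , newColumn) ≡ v
    entry-new = subst (λ c → entry μ (appendAt i v F) (i , c) ≡ v) (row-removeBox-≡ λ′ i)
                      (entry-appendAt-new shape i<ℓ)

    nothing-after-new : ∀ {b} → SkewBox λ′ μ b → ¬ ((i , newColumn) ◁ b)
    nothing-after-new (_ , c′<λ) (leftOf new<c′) = <-irrefl refl (<-≤-trans new<c′ (<⇒≤pred c′<λ))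
    nothing-after-new (_ , new<λ′) (above i<i′) =
      <-irrefl refl (<-≤-trans new<λ′ (≤-trans (IsDiagram-mono λ′ λ↓ i<i′) (<⇒≤pred (proj₂ corner))))

  IsStandard-appendAt⇔ : IsStandard (removeBox λ′ i) μ F ⇔ IsStandard λ′ μ (appendAt i v F)
  IsStandard-appendAt⇔ = mk⇔ ⇒ ⇐
    where
    ⇒ : IsStandard (removeBox λ′ i) μ F → IsStandard λ′ μ (appendAt i v F)
    ⇒ (u , inc) = from (Unique-appendAt⇔ i v F i<ℓ) (v∉F , u) , inc⁺
      where
      inc⁺ : Increasing λ′ μ (appendAt i v F)
      inc⁺ {j , c} {j′ , c′} a∈ b∈ a◁b with SkewBox-split λ′ μ i a∈ | SkewBox-split λ′ μ i b∈
      ... | inj₂ (refl , refl) | _                  = ⊥-elim (nothing-after-new b∈ a◁b)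
      ... | inj₁ a∈′           | inj₁ b∈′           =
        subst₂ _<_ (sym (entry-appendAt-old shape a∈′)) (sym (entry-appendAt-old shape b∈′)) (inc a∈′ b∈′ a◁b)
      ... | inj₁ a∈′           | inj₂ (refl , refl) =
        subst₂ _<_ (sym (entry-appendAt-old shape a∈′)) (sym entry-new)
                   (s≤s (proj₂ (All.lookup bounded (entry-∈-concat shape a∈′))))
    ⇐ : IsStandard λ′ μ (appendAt i v F) → IsStandard (removeBox λ′ i) μ F
    ⇐ (u⁺ , inc⁺) = proj₂ (to (Unique-appendAt⇔ i v F i<ℓ) u⁺) , inc
      where
      inc : Increasing (removeBox λ′ i) μ F
      inc {j , c} {j′ , c′} a∈ b∈ a◁b =
        subst₂ _<_ (entry-appendAt-old shape a∈) (entry-appendAt-old shape b∈)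
                   (inc⁺ (SkewBox-removeBox λ′ μ i a∈) (SkewBox-removeBox λ′ μ i b∈) a◁b)

HasShape-size : ∀ λ′ μ F → μ ⊆ᴾ λ′ → HasShape λ′ μ F → length (concat F) + size μ ≡ size λ′
HasShape-size []       μ []      μ⊆λ _ = n≤0⇒n≡0 (size-mono μ [] μ⊆λ)
HasShape-size (a ∷ λ′) μ (r ∷ F) μ⊆λ (mkShape ℓ ℓs) = begin
  length (r ++ concat F) + size μ                              ≡⟨ cong₂ _+_ (length-++ r) (size-∷ μ) ⟩
  (length r + length (concat F)) + (row μ 0 + size (drop 1 μ)) ≡⟨ interchange (length r) _ _ _ ⟩
  (length r + row μ 0) + (length (concat F) + size (drop 1 μ)) ≡⟨ cong₂ _+_ firstRow rest ⟩
  a + size λ′                                                  ∎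
  where
  open ≡-Reasoning
  firstRow : length r + row μ 0 ≡ a
  firstRow = trans (cong (_+ row μ 0) (ℓs 0)) (m∸n+n≡m (μ⊆λ 0))
  rest : length (concat F) + size (drop 1 μ) ≡ size λ′
  rest = HasShape-size λ′ (drop 1 μ) F (⊆ᴾ-drop1 μ (a ∷ λ′) μ⊆λ)
           (mkShape (suc-injective ℓ) (λ i → trans (ℓs (suc i)) (cong (row λ′ i ∸_) (sym (row-drop1 μ i)))))

∈-concat⇒∈-getR : ∀ F {x} → x ∈ concat F → ∃ λ i → x ∈ getR F i
∈-concat⇒∈-getR (r ∷ F) x∈ with ∈-++⁻ r x∈
... | inj₁ x∈r = 0 , x∈r
... | inj₂ x∈F = let i , x∈Fᵢ = ∈-concat⇒∈-getR F x∈F in suc i , x∈Fᵢ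

∈⇒getL : ∀ r {x} → x ∈ r → ∃ λ m → m < length r × getL r m ≡ x
∈⇒getL (y ∷ r) (here refl) = 0 , s≤s z≤n , refl
∈⇒getL (y ∷ r) (there x∈) = let m , m<ℓ , getL≡ = ∈⇒getL r x∈ in suc m , s≤s m<ℓ , getL≡

∈-concat⇒entry : ∀ {λ′ μ F x} → HasShape λ′ μ F → x ∈ concat F → ∃ λ a → SkewBox λ′ μ a × entry μ F a ≡ x
∈-concat⇒entry {λ′} {μ} {F} shape x∈
  with i , x∈Fᵢ ← ∈-concat⇒∈-getR F x∈
  with m , m<ℓ , getL≡ ← ∈⇒getL (getR F i) x∈Fᵢ =
  (i , row μ i + m) , (m≤m+n (row μ i) m , μ+m<λ) , trans (cong (getL (getR F i)) (m+n∸m≡n (row μ i) m)) getL≡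
  where
  m<λ∸μ : m < row λ′ i ∸ row μ i
  m<λ∸μ = subst (m <_) (rowLength shape i) m<ℓ
  μ+m<λ : row μ i + m < row λ′ i
  μ+m<λ = subst (row μ i + m <_) (m+[n∸m]≡n (<⇒≤ μ<λ)) (+-monoʳ-< (row μ i) m<λ∸μ)
    where
    μ<λ : row μ i < row λ′ i
    μ<λ = m∸n≢0⇒n<m (λ λ∸μ≡0 → n≮0 (subst (m <_) λ∸μ≡0 m<λ∸μ))

largest-entry-∈ : ∀ {K} F → Unique (concat F) → EntriesIn (suc K) F → length (concat F) ≡ suc K →
  suc K ∈ concat F
largest-entry-∈ {K} F u bounded ℓ with suc K ∈? concat F
... | yes v∈ = v∈
... | no  v∉ = ⊥-elim (1+n≰n (subst₂ _≤_ ℓ (length-applyUpTo suc K)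
  (Unique-length-≤ u (Unique.applyUpTo⁺₁ suc K (λ i<j _ → <⇒≢ i<j ∘ suc-injective))
    (λ x∈ → let x>0 , x≤v = All.lookup bounded x∈ in
      from ∈-applyUpTo-suc⇔ (x>0 , ≤-pred (≤∧≢⇒< x≤v λ { refl → v∉ x∈ }))))))

maximum-at-corner : ∀ {λ′ μ F v i c} → IsDiagram μ → Increasing λ′ μ F →
  (∀ {b} → SkewBox λ′ μ b → entry μ F b ≤ v) → SkewBox λ′ μ (i , c) → entry μ F (i , c) ≡ v →
  suc c ≡ row λ′ i × row λ′ (suc i) < row λ′ i
maximum-at-corner {λ′} {μ} {F} {v} {i} {c} μ↓ inc ≤v a∈@(μ≤c , c<λ) a≡v = lastInRow , shorterBelow
  where
  nothingAfter : ∀ {b} → SkewBox λ′ μ b → ¬ (i , c) ◁ b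
  nothingAfter b∈ a◁b = <-irrefl refl (<-≤-trans (subst (_< entry μ F _) a≡v (inc a∈ b∈ a◁b)) (≤v b∈))
  lastInRow : suc c ≡ row λ′ i
  lastInRow with suc c <? row λ′ i
  ... | yes c+1<λ = ⊥-elim (nothingAfter (≤-trans μ≤c (n≤1+n c) , c+1<λ) (leftOf (n<1+n c)))
  ... | no  c+1≮λ = ≤-antisym c<λ (≮⇒≥ c+1≮λ)
  shorterBelow : row λ′ (suc i) < row λ′ i
  shorterBelow with row λ′ (suc i) <? row λ′ i
  ... | yes below<λ = below<λ
  ... | no  below≮λ = ⊥-elim (nothingAfter (≤-trans (μ↓ i) μ≤c , <-≤-trans c<λ (≮⇒≥ below≮λ)) (above (n<1+n i)))

-- Standard fillings are paths

-- The standard fillings of λ/μ with entries 1..K+1 correspond to the pairs of a corner i and a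
-- standard filling of (removeBox λ i)/μ: split takes the entry K+1 out of its row, join puts it back.
module _ {λ′ μ K} (λ↓ : IsDiagram λ′) (μ↓ : IsDiagram μ) (μ⊆λ : μ ⊆ᴾ λ′) (sizes : size λ′ ≡ size μ + suc K) where

  private
    v = suc K

    smallerCandidates : ℕ → List Filling
    smallerCandidates i = candidates (removeBox λ′ i) μ K

    isStandardᵢ : ℕ × Filling → Bool
    isStandardᵢ (i , F) = isStandard (removeBox λ′ i) μ F

    split : Filling → ℕ × Filling
    split F = rowOf v F , removeLastAt (rowOf v F) F

    join : ℕ × Filling → Filling
    join (i , F) = appendAt i v F

  filled : ∀ {F} → HasShape λ′ μ F → length (concat F) ≡ v
  filled {F} shape =
    +-cancelʳ-≡ (size μ) _ _ (trans (HasShape-size λ′ μ F μ⊆λ shape) (trans sizes (+-comm (size μ) v)))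

  standard⇒appendAt : ∀ {F} → HasShape λ′ μ F → EntriesIn v F → IsStandard λ′ μ F →
    ∃ λ i → IsCorner λ′ μ i × appendAt i v (removeLastAt i F) ≡ F
  standard⇒appendAt {F} shape bounded (u , inc)
    with (i , c) , a∈@(μ≤c , c<λ) , a≡v ← ∈-concat⇒entry shape (largest-entry-∈ F u bounded (filled shape))
    with lastInRow , shorterBelow ← maximum-at-corner {λ′} {μ} {F} μ↓ inc
                                      (λ b∈ → proj₂ (All.lookup bounded (entry-∈-concat shape b∈))) a∈ a≡v
    = i , (≤-<-trans μ≤c c<λ , shorterBelow) , appendAt-removeLastAt i v F (dropLast-++-last (getR F i) rowLen a≡v)
    where
    rowLen : length (getR F i) ≡ suc (c ∸ row μ i)
    rowLen = trans (rowLength shape i) (trans (cong (_∸ row μ i) (sym lastInRow)) (+-∸-assoc 1 μ≤c))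

  removeLast-valid : ∀ {i F} → IsCorner λ′ μ i →
    HasShape λ′ μ (appendAt i v F) → EntriesIn v (appendAt i v F) → IsStandard λ′ μ (appendAt i v F) →
    HasShape (removeBox λ′ i) μ F × EntriesIn K F × IsStandard (removeBox λ′ i) μ F
  removeLast-valid {i} {F} corner shape bounded std =
    shape′ , bounded′ , from (IsStandard-appendAt⇔ λ↓ corner shape′ bounded′) std
    where
    i<ℓ : i < length F
    i<ℓ = subst (i <_) (trans (sym (rowCount shape)) (length-updateRow i _ F))
                (row>0⇒<length λ′ (≤-<-trans z≤n (proj₁ corner)))
    shape′ = from (HasShape-appendAt⇔ λ′ μ i v F (proj₁ corner) i<ℓ) shape
    bounded′ = EntriesIn-removed i K F i<ℓ bounded (proj₁ (to (Unique-appendAt⇔ i v F i<ℓ) (proj₁ std)))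

  split∘join : ∀ {i F} → IsCorner λ′ μ i → HasShape (removeBox λ′ i) μ F → EntriesIn K F →
    split (join (i , F)) ≡ (i , F)
  split∘join {i} {F} corner shape bounded
    rewrite rowOf-appendAt i v F (EntriesIn⇒suc∉ F bounded) (corner<length corner shape) =
    cong (i ,_) (removeLastAt-appendAt i v F)

  join-valid : ∀ {y} → y ∈ tagged smallerCandidates (corners λ′ μ) → T (isStandardᵢ y) →
    join y ∈ candidates λ′ μ v × T (isStandard λ′ μ (join y)) × split (join y) ≡ y
  join-valid {i , F} y∈ isStd =
    from (∈-candidates⇔ λ′ μ v)
      (to (HasShape-appendAt⇔ λ′ μ i v F (proj₁ corner) i<ℓ) shape , EntriesIn-appendAt i K F i<ℓ bounded) ,
    from (T-isStandard λ′ μ (appendAt i v F))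
      (to (IsStandard-appendAt⇔ λ↓ corner shape bounded) (to (T-isStandard (removeBox λ′ i) μ F) isStd)) ,
    split∘join corner shape bounded
    where
    corner = to (∈-corners⇔ λ′ μ) (proj₁ (∈-tagged⁻ smallerCandidates (corners λ′ μ) y∈))
    shape×bounded = to (∈-candidates⇔ (removeBox λ′ i) μ K) (proj₂ (∈-tagged⁻ smallerCandidates (corners λ′ μ) y∈))
    shape = proj₁ shape×bounded
    bounded = proj₂ shape×bounded
    i<ℓ = corner<length corner shape

  SplitsValidly : Filling → Set
  SplitsValidly F =
    split F ∈ tagged smallerCandidates (corners λ′ μ) × T (isStandardᵢ (split F)) × join (split F) ≡ F

  joined-splitsValidly : ∀ {i F} → IsCorner λ′ μ i → HasShape (removeBox λ′ i) μ F → EntriesIn K F →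
    IsStandard (removeBox λ′ i) μ F → SplitsValidly (join (i , F))
  joined-splitsValidly {i} {F} corner shape bounded std =
    subst (λ y → y ∈ tagged smallerCandidates (corners λ′ μ) × T (isStandardᵢ y) × join y ≡ join (i , F))
          (sym (split∘join corner shape bounded))
          (∈-tagged⁺ smallerCandidates (from (∈-corners⇔ λ′ μ) corner)
                                       (from (∈-candidates⇔ (removeBox λ′ i) μ K) (shape , bounded)) ,
           from (T-isStandard (removeBox λ′ i) μ F) std , refl)

  split-valid : ∀ {F} → F ∈ candidates λ′ μ v → T (isStandard λ′ μ F) → SplitsValidly F
  split-valid {F} F∈ isStd
    with shape , bounded ← to (∈-candidates⇔ λ′ μ v) F∈
    with i , corner , F≡ ← standard⇒appendAt shape bounded (to (T-isStandard λ′ μ F) isStd)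
    with shape′ , bounded′ , std′ ← removeLast-valid corner (subst (HasShape λ′ μ) (sym F≡) shape)
                                       (subst (EntriesIn v) (sym F≡) bounded)
                                       (subst (IsStandard λ′ μ) (sym F≡) (to (T-isStandard λ′ μ F) isStd))
    = subst SplitsValidly F≡ (joined-splitsValidly corner shape′ bounded′ std′)

  countStandard-suc : countB (isStandard λ′ μ) (candidates λ′ μ v) ≡
    sum (map (λ i → countB (isStandard (removeBox λ′ i) μ) (candidates (removeBox λ′ i) μ K)) (corners λ′ μ))
  countStandard-suc = trans
    (countB-bijection split join (Unique-candidates λ′ μ v)
      (Unique-tagged smallerCandidates (Unique-corners λ′ μ) (λ i → Unique-candidates (removeBox λ′ i) μ K))
      split-valid join-valid)
    (countB-tagged smallerCandidates isStandardᵢ (corners λ′ μ))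

emptyFilling : List ℕ → Filling
emptyFilling = map (λ _ → [])

getR-emptyFilling : ∀ λ′ i → getR (emptyFilling λ′) i ≡ []
getR-emptyFilling []       i       = refl
getR-emptyFilling (_ ∷ λ′) zero    = refl
getR-emptyFilling (_ ∷ λ′) (suc i) = getR-emptyFilling λ′ i

concat-emptyFilling : ∀ λ′ → concat (emptyFilling λ′) ≡ []
concat-emptyFilling []       = refl
concat-emptyFilling (_ ∷ λ′) = concat-emptyFilling λ′

≡emptyFilling : ∀ λ′ F → length F ≡ length λ′ → (∀ i → length (getR F i) ≡ 0) → F ≡ emptyFilling λ′
≡emptyFilling []       []            _ _  = refl
≡emptyFilling (_ ∷ λ′) ([] ∷ F)      ℓ ℓs = cong ([] ∷_) (≡emptyFilling λ′ F (suc-injective ℓ) (ℓs ∘ suc))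
≡emptyFilling (_ ∷ λ′) ((_ ∷ _) ∷ F) ℓ ℓs with () ← ℓs 0

countStandard-zero : ∀ λ′ μ → μ ⊆ᴾ λ′ → size λ′ ≡ size μ + 0 →
  countB (isStandard λ′ μ) (candidates λ′ μ 0) ≡ 1
countStandard-zero λ′ μ μ⊆λ sizes =
  countB-bijection (λ _ → tt) (λ _ → emptyFilling λ′) (Unique-candidates λ′ μ 0) ([] ∷ []) only-empty empty-valid
  where
  same : SameRows λ′ μ
  same = size≡⇒SameRows μ λ′ μ⊆λ (trans sizes (+-identityʳ (size μ)))
  noRows : ∀ i → row λ′ i ∸ row μ i ≡ 0
  noRows i = trans (cong (_∸ row μ i) (same i)) (n∸n≡0 (row μ i))
  only-empty : ∀ {F} → F ∈ candidates λ′ μ 0 → T (isStandard λ′ μ F) → tt ∈ tt ∷ [] × ⊤ × emptyFilling λ′ ≡ F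
  only-empty F∈ _ with mkShape ℓ ℓs , _ ← to (∈-candidates⇔ λ′ μ 0) F∈ =
    here refl , tt , sym (≡emptyFilling λ′ _ ℓ (λ i → trans (ℓs i) (noRows i)))
  empty-valid : ∀ {y} → y ∈ tt ∷ [] → ⊤ →
    emptyFilling λ′ ∈ candidates λ′ μ 0 × T (isStandard λ′ μ (emptyFilling λ′)) × tt ≡ y
  empty-valid (here refl) _ =
    from (∈-candidates⇔ λ′ μ 0)
      (mkShape (length-map _ λ′) (λ i → trans (cong length (getR-emptyFilling λ′ i)) (sym (noRows i))) ,
       subst (All _) (sym (concat-emptyFilling λ′)) []) ,
    from (T-isStandard λ′ μ (emptyFilling λ′))
      (subst Unique (sym (concat-emptyFilling λ′)) [] ,
       λ { (μ≤c , c<λ) → ⊥-elim (<-irrefl refl (<-≤-trans c<λ (subst (_≤ _) (sym (same _)) μ≤c))) }) ,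
    refl

countStandard≡paths : ∀ K λ′ μ → IsDiagram λ′ → IsDiagram μ → μ ⊆ᴾ λ′ → size λ′ ≡ size μ + K →
  countB (isStandard λ′ μ) (candidates λ′ μ K) ≡ paths K λ′ μ
countStandard≡paths zero    λ′ μ λ↓ μ↓ μ⊆λ sizes = countStandard-zero λ′ μ μ⊆λ sizes
countStandard≡paths (suc K) λ′ μ λ↓ μ↓ μ⊆λ sizes =
  trans (countStandard-suc {λ′} {μ} {K} λ↓ μ↓ μ⊆λ sizes) (cong sum (map-cong-local (All.tabulate λ {i} i∈ →
    let λ′↓ , μ⊆λ′ , sizes′ = removeCorner λ′ μ λ↓ μ⊆λ sizes (to (∈-corners⇔ λ′ μ) i∈) in
    countStandard≡paths K (removeBox λ′ i) μ λ′↓ μ↓ μ⊆λ′ sizes′)))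

dSkew≡paths : ∀ λ′ μ → IsDiagram λ′ → IsDiagram μ → μ ⊆ᴾ λ′ → dSkew λ′ μ ≡ paths (size λ′ ∸ size μ) λ′ μ
dSkew≡paths λ′ μ λ↓ μ↓ μ⊆λ =
  countStandard≡paths (size λ′ ∸ size μ) λ′ μ λ↓ μ↓ μ⊆λ (sym (m+[n∸m]≡n (size-mono μ λ′ μ⊆λ)))

d≡paths : ∀ ν → IsDiagram ν → d ν ≡ paths (size ν) ν []
d≡paths ν ν↓ = dSkew≡paths ν [] ν↓ (λ _ → z≤n) (λ _ → z≤n)

-- Binomial estimates

C-mono : ∀ n k → n C k ≤ suc n C k
C-mono n zero    = ≤-refl
C-mono n (suc k) = subst (n C suc k ≤_) (nCk+nC[k+1]≡[n+1]C[k+1] n k) (m≤n+m _ _)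

C-antitone : ∀ a j → a ≤ suc j → a C suc j ≤ a C j
C-antitone a j a≤1+j with m≤n⇒m<n∨m≡n a≤1+j
... | inj₁ a<1+j = subst (_≤ a C j) (sym (k>n⇒nCk≡0 a<1+j)) z≤n
... | inj₂ refl  = begin
  suc j C suc j       ≡⟨ nCn≡1 (suc j) ⟩
  1                   ≤⟨ s≤s z≤n ⟩
  suc j               ≡⟨ nC1≡n (suc j) ⟨
  suc j C 1           ≡⟨ cong (suc j C_) (m+n∸n≡m 1 j) ⟨
  suc j C (suc j ∸ j) ≡⟨ nCk≡nC[n∸k] (n≤1+n j) ⟨
  suc j C j           ∎
  where open ≤-Reasoning

C-absorption : ∀ n k → (suc n C suc k) * suc k ≡ suc n * (n C k)
C-absorption zero    zero    = refl
C-absorption zero    (suc k) = refl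
C-absorption (suc n) zero    = begin
  (suc (suc n) C 1) * 1 ≡⟨ *-identityʳ (suc (suc n) C 1) ⟩
  suc (suc n) C 1     ≡⟨ nC1≡n (suc (suc n)) ⟩
  suc (suc n)         ≡⟨ *-identityʳ (suc (suc n)) ⟨
  suc (suc n) * 1     ∎
  where open ≡-Reasoning
C-absorption (suc n) (suc k) = begin
  (suc (suc n) C suc (suc k)) * suc (suc k)
    ≡⟨ cong (_* suc (suc k)) (nCk+nC[k+1]≡[n+1]C[k+1] (suc n) (suc k)) ⟨
  (suc n C suc k + suc n C suc (suc k)) * suc (suc k)
    ≡⟨ expand (suc n C suc k) (suc n C suc (suc k)) (suc k) ⟩
  suc n C suc k + ((suc n C suc k) * suc k + (suc n C suc (suc k)) * suc (suc k))
    ≡⟨ cong (suc n C suc k +_) (cong₂ _+_ (C-absorption n k) (C-absorption n (suc k))) ⟩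
  suc n C suc k + (suc n * (n C k) + suc n * (n C suc k))
    ≡⟨ cong (suc n C suc k +_) (*-distribˡ-+ (suc n) (n C k) (n C suc k)) ⟨
  suc n C suc k + suc n * (n C k + n C suc k)
    ≡⟨ cong (λ x → suc n C suc k + suc n * x) (nCk+nC[k+1]≡[n+1]C[k+1] n k) ⟩
  suc n C suc k + suc n * (suc n C suc k)
    ∎
  where
  open ≡-Reasoning
  expand : ∀ x y m → (x + y) * suc m ≡ x + (x * m + y * suc m)
  expand = solve-∀

C*!≤^ : ∀ n k → (n C k) * k ! ≤ n ^ k
C*!≤^ n       zero    = ≤-refl
C*!≤^ zero    (suc k) = z≤n
C*!≤^ (suc n) (suc k) = begin
  (suc n C suc k) * (suc k * k !) ≡⟨ *-assoc (suc n C suc k) (suc k) (k !) ⟨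
  (suc n C suc k) * suc k * k !   ≡⟨ cong (_* k !) (C-absorption n k) ⟩
  suc n * (n C k) * k !           ≡⟨ *-assoc (suc n) (n C k) (k !) ⟩
  suc n * ((n C k) * k !)         ≤⟨ *-monoʳ-≤ (suc n) (≤-trans (C*!≤^ n k) (^-monoˡ-≤ k (n≤1+n n))) ⟩
  suc n * suc n ^ k             ∎
  where open ≤-Reasoning

^≤C*! : ∀ n k → (suc n ∸ k) ^ k ≤ (n C k) * k !
^≤C*! n       zero    = ≤-refl
^≤C*! zero    (suc k) rewrite 0∸n≡0 k = z≤n
^≤C*! (suc n) (suc k) = begin
  (suc n ∸ k) * (suc n ∸ k) ^ k ≤⟨ *-mono-≤ (m∸n≤m (suc n) k) (^≤C*! n k) ⟩
  suc n * ((n C k) * k !)         ≡⟨ *-assoc (suc n) (n C k) (k !) ⟨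
  suc n * (n C k) * k !           ≡⟨ cong (_* k !) (C-absorption n k) ⟨
  (suc n C suc k) * suc k * k !   ≡⟨ *-assoc (suc n C suc k) (suc k) (k !) ⟩
  (suc n C suc k) * (suc k * k !) ∎
  where open ≤-Reasoning

C≤^ : ∀ n k → n C k ≤ n ^ k
C≤^ n k = ≤-trans (m≤m*n (n C k) (k !) {{k !≢0}}) (C*!≤^ n k)

!≤!*^ : ∀ m l → (m + l) ! ≤ m ! * (m + l) ^ l
!≤!*^ m zero    = ≤-reflexive (trans (cong _! (+-identityʳ m)) (sym (*-identityʳ (m !))))
!≤!*^ m (suc l) rewrite +-suc m l = begin
  suc (m + l) * (m + l) !             ≤⟨ *-monoʳ-≤ (suc (m + l)) (!≤!*^ m l) ⟩
  suc (m + l) * (m ! * (m + l) ^ l)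
    ≤⟨ *-monoʳ-≤ (suc (m + l)) (*-monoʳ-≤ (m !) (^-monoˡ-≤ l (n≤1+n (m + l)))) ⟩
  suc (m + l) * (m ! * suc (m + l) ^ l) ≡⟨ x*[y*z]≡y*[x*z] (suc (m + l)) (m !) _ ⟩
  m ! * (suc (m + l) * suc (m + l) ^ l) ∎
  where
  open ≤-Reasoning
  x*[y*z]≡y*[x*z] : ∀ x y z → x * (y * z) ≡ y * (x * z)
  x*[y*z]≡y*[x*z] = solve-∀

n<2^n : ∀ n → n < 2 ^ n
n<2^n zero    = s≤s z≤n
n<2^n (suc n) = +-mono-≤-< (m^n>0 2 n) (subst (n <_) (sym (+-identityʳ (2 ^ n))) (n<2^n n))

1+n≤4^n : ∀ n → suc n ≤ 4 ^ n
1+n≤4^n zero    = ≤-refl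
1+n≤4^n (suc n) = ≤-trans (subst (2 + n ≤_) (sym (*-suc 4 n)) (+-mono-≤ (s≤s (s≤s (z≤n {2}))) (m≤n*m n 4)))
                          (*-monoʳ-≤ 4 (1+n≤4^n n))

4*n≤4^n : ∀ n → 4 * n ≤ 4 ^ n
4*n≤4^n zero    = z≤n
4*n≤4^n (suc n) = *-monoʳ-≤ 4 (1+n≤4^n n)

[m*n]^k≡m^k*n^k : ∀ m n k → (m * n) ^ k ≡ m ^ k * n ^ k
[m*n]^k≡m^k*n^k m n zero    = refl
[m*n]^k≡m^k*n^k m n (suc k) = trans (cong (m * n *_) ([m*n]^k≡m^k*n^k m n k)) (interchange-* m n (m ^ k) (n ^ k))
  where
  interchange-* : ∀ a b c d → a * b * (c * d) ≡ a * c * (b * d)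
  interchange-* = solve-∀

a+j≤2*[1+a∸j] : ∀ a j → 4 * j < a + j → a + j ≤ 2 * (suc a ∸ j)
a+j≤2*[1+a∸j] a j 4j<a+j = go (m≤n⇒∃[o]m+o≡n (+-cancelʳ-< j (3 * j) a (subst (_< a + j) (split4 j) 4j<a+j)))
  where
  split4 : ∀ j → 4 * j ≡ 3 * j + j
  split4 = solve-∀
  shift : ∀ j r → suc (suc (3 * j) + r) ≡ (2 + 2 * j + r) + j
  shift = solve-∀
  double : ∀ j r → 2 * (2 + 2 * j + r) ≡ (suc (3 * j) + r + j) + (3 + r)
  double = solve-∀
  go : ∃ (λ r → suc (3 * j) + r ≡ a) → a + j ≤ 2 * (suc a ∸ j)
  go (r , refl) rewrite shift j r | m+n∸n≡m (2 + 2 * j + r) j | double j r = m≤m+n _ _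

j^l*2^j≤[4^j]^l : ∀ j l → 1 ≤ l → j ^ l * 2 ^ j ≤ (4 ^ j) ^ l
j^l*2^j≤[4^j]^l j l@(suc l′) _ = begin
  j ^ l * 2 ^ j             ≤⟨ *-mono-≤ (^-monoˡ-≤ l (<⇒≤ (n<2^n j))) (m≤m*n (2 ^ j) ((2 ^ j) ^ l′)) ⟩
  (2 ^ j) ^ l * (2 ^ j) ^ l ≡⟨ [m*n]^k≡m^k*n^k (2 ^ j) (2 ^ j) l ⟨
  (2 ^ j * 2 ^ j) ^ l       ≡⟨ cong (_^ l) ([m*n]^k≡m^k*n^k 2 2 j) ⟨
  (4 ^ j) ^ l               ∎
  where
  open ≤-Reasoning
  instance
    2^j≢0 : NonZero (2 ^ j)
    2^j≢0 = m^n≢0 2 j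
    [2^j]^l′≢0 : NonZero ((2 ^ j) ^ l′)
    [2^j]^l′≢0 = m^n≢0 (2 ^ j) l′

-- Multiplied by m! j^l 2^j, this follows from C(s,m) m! ≤ n^m, C(k,l) ≤ k^l, j^l 2^j ≤ 4^(jl) and
-- n^j ≤ 2^j (a+1-j)^j ≤ 2^j C(a,j) j! ≤ 2^j C(a,j) m! j^l, whose first step needs 4j < n.
binomial-bound : ∀ {a j m l k s n} → a + j ≡ n → m + l ≡ j → 1 ≤ l → 1 ≤ k → s ≤ n → 4 ^ j * k < n →
  (s C m) * (k C l) * n ^ l ≤ (4 ^ j * k) ^ l * (a C j)
binomial-bound {a} {j} {m} {l} {k} {s} {n} refl m+l≡j l≥1 k≥1 s≤n 4ʲk<n = *-cancelʳ-≤ _ _ M (begin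
  (s C m) * (k C l) * n ^ l * M
    ≡⟨ regroup₁ (s C m) (k C l) (n ^ l) (m !) (j ^ l * 2 ^ j) ⟩
  (s C m) * m ! * (k C l) * n ^ l * (j ^ l * 2 ^ j)
    ≤⟨ *-mono-≤ (*-monoˡ-≤ (n ^ l) (*-mono-≤ sCm*m!≤nᵐ (C≤^ k l))) (j^l*2^j≤[4^j]^l j l l≥1) ⟩
  n ^ m * k ^ l * n ^ l * (4 ^ j) ^ l
    ≡⟨ regroup₂ (n ^ m) (k ^ l) (n ^ l) ((4 ^ j) ^ l) ⟩
  n ^ m * n ^ l * (k ^ l * (4 ^ j) ^ l)
    ≡⟨ cong (_* (k ^ l * (4 ^ j) ^ l)) nᵐ*nˡ≡nʲ ⟩
  n ^ j * (k ^ l * (4 ^ j) ^ l)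
    ≤⟨ *-monoˡ-≤ (k ^ l * (4 ^ j) ^ l) nʲ≤ ⟩
  2 ^ j * ((a C j) * (m ! * j ^ l)) * (k ^ l * (4 ^ j) ^ l)
    ≡⟨ regroup₃ (2 ^ j) (a C j) (m !) (j ^ l) (k ^ l) ((4 ^ j) ^ l) ⟩
  (4 ^ j) ^ l * k ^ l * (a C j) * M
    ≡⟨ cong (λ x → x * (a C j) * M) ([m*n]^k≡m^k*n^k (4 ^ j) k l) ⟨
  (4 ^ j * k) ^ l * (a C j) * M
    ∎)
  where
  open ≤-Reasoning
  M = m ! * (j ^ l * 2 ^ j)
  instance
    j≢0 : NonZero j
    j≢0 = >-nonZero (subst (0 <_) m+l≡j (≤-trans l≥1 (m≤n+m l m)))
    2^j≢0 : NonZero (2 ^ j)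
    2^j≢0 = m^n≢0 2 j
    j^l≢0 : NonZero (j ^ l)
    j^l≢0 = m^n≢0 j l
    M≢0 : NonZero M
    M≢0 = m*n≢0 (m !) (j ^ l * 2 ^ j) {{m !≢0}} {{m*n≢0 (j ^ l) (2 ^ j)}}
  regroup₁ : ∀ x y z u w → x * y * z * (u * w) ≡ x * u * y * z * w
  regroup₁ = solve-∀
  regroup₂ : ∀ x y z w → x * y * z * w ≡ x * z * (y * w)
  regroup₂ = solve-∀
  regroup₃ : ∀ p c f q y z → p * (c * (f * q)) * (y * z) ≡ z * y * c * (f * (q * p))
  regroup₃ = solve-∀
  sCm*m!≤nᵐ : (s C m) * m ! ≤ n ^ m
  sCm*m!≤nᵐ = ≤-trans (C*!≤^ s m) (^-monoˡ-≤ m s≤n)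
  nᵐ*nˡ≡nʲ : n ^ m * n ^ l ≡ n ^ j
  nᵐ*nˡ≡nʲ = trans (sym (^-distribˡ-+-* n m l)) (cong (n ^_) m+l≡j)
  4j<n : 4 * j < n
  4j<n = ≤-<-trans (≤-trans (4*n≤4^n j) (m≤m*n (4 ^ j) k {{>-nonZero k≥1}})) 4ʲk<n
  j!≤m!*jˡ : j ! ≤ m ! * j ^ l
  j!≤m!*jˡ = subst (λ i → i ! ≤ m ! * i ^ l) m+l≡j (!≤!*^ m l)
  nʲ≤ : n ^ j ≤ 2 ^ j * ((a C j) * (m ! * j ^ l))
  nʲ≤ = begin
    n ^ j                        ≤⟨ ^-monoˡ-≤ j (a+j≤2*[1+a∸j] a j 4j<n) ⟩
    (2 * (suc a ∸ j)) ^ j        ≡⟨ [m*n]^k≡m^k*n^k 2 (suc a ∸ j) j ⟩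
    2 ^ j * (suc a ∸ j) ^ j      ≤⟨ *-monoʳ-≤ (2 ^ j) (^≤C*! a j) ⟩
    2 ^ j * ((a C j) * j !)      ≤⟨ *-monoʳ-≤ (2 ^ j) (*-monoʳ-≤ (a C j) j!≤m!*jˡ) ⟩
    2 ^ j * ((a C j) * (m ! * j ^ l)) ∎

-- Estimates for paths

pathsBelow : ℕ → ℕ → List ℕ → List ℕ → ℕ
pathsBelow K a ν μ = sum (map (λ i → paths K (a ∷ removeBox ν i) μ) (corners ν (drop 1 μ)))

paths-∷-corner : ∀ K a ν μ → IsCorner (a ∷ ν) μ 0 →
  paths (suc K) (a ∷ ν) μ ≡ paths K (pred a ∷ ν) μ + pathsBelow K a ν μ
paths-∷-corner K a ν μ (μ<a , ν<a) rewrite to T-≡ (<⇒<ᵇ μ<a) | to T-≡ (<⇒<ᵇ ν<a) =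
  cong (paths K (pred a ∷ ν) μ +_) (cong sum (sym (map-∘ (corners ν (drop 1 μ)))))

paths-∷-nonCorner : ∀ K a ν μ → ¬ IsCorner (a ∷ ν) μ 0 → paths (suc K) (a ∷ ν) μ ≡ pathsBelow K a ν μ
paths-∷-nonCorner K a ν μ ¬corner with (row μ 0 <ᵇ a) ∧ (row ν 0 <ᵇ a) in eq
... | true  = ⊥-elim (¬corner (let μ<a , ν<a = to T-∧ (subst T (sym eq) tt) in <ᵇ⇒< _ _ μ<a , <ᵇ⇒< _ _ ν<a))
... | false = cong sum (sym (map-∘ (corners ν (drop 1 μ))))

paths-through-≤ : ∀ K λ′ μ → IsDiagram λ′ → IsDiagram μ → μ ⊆ᴾ λ′ → size λ′ ≡ size μ + K →
  paths (size μ) μ [] * paths K λ′ μ ≤ paths (size λ′) λ′ []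
paths-through-≤ zero    λ′ μ λ↓ μ↓ μ⊆λ sizes = ≤-reflexive (begin
  paths (size μ) μ [] * 1 ≡⟨ *-identityʳ _ ⟩
  paths (size μ) μ []     ≡⟨ cong (λ n → paths n μ []) (sym sizes′) ⟩
  paths (size λ′) μ []    ≡⟨ paths-cong (size λ′) μ λ′ [] [] (sym ∘ size≡⇒SameRows μ λ′ μ⊆λ sizes′) (λ _ → refl) ⟩
  paths (size λ′) λ′ []   ∎)
  where
  open ≡-Reasoning
  sizes′ : size λ′ ≡ size μ
  sizes′ = trans sizes (+-identityʳ (size μ))
paths-through-≤ (suc K) λ′ μ λ↓ μ↓ μ⊆λ sizes = begin
  paths (size μ) μ [] * paths (suc K) λ′ μ
    ≡⟨ *-sum-map (paths (size μ) μ []) (λ i → paths K (removeBox λ′ i) μ) (corners λ′ μ) ⟩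
  sum (map (λ i → paths (size μ) μ [] * paths K (removeBox λ′ i) μ) (corners λ′ μ))
    ≤⟨ sum-map-mono (corners λ′ μ) step ⟩
  sum (map (λ i → paths (size μ + K) (removeBox λ′ i) []) (corners λ′ μ))
    ≤⟨ sum-map-⊆ _ (corners-⊆ λ′ μ) ⟩
  paths (suc (size μ + K)) λ′ []
    ≡⟨ cong (λ n → paths n λ′ []) (sym (trans sizes (+-suc (size μ) K))) ⟩
  paths (size λ′) λ′ []
    ∎
  where
  open ≤-Reasoning
  step : ∀ {i} → i ∈ corners λ′ μ →
    paths (size μ) μ [] * paths K (removeBox λ′ i) μ ≤ paths (size μ + K) (removeBox λ′ i) []
  step {i} i∈ = let λ′↓ , μ⊆λ′ , sizes′ = removeCorner λ′ μ λ↓ μ⊆λ sizes (to (∈-corners⇔ λ′ μ) i∈) in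
    subst (λ n → paths (size μ) μ [] * paths K (removeBox λ′ i) μ ≤ paths n (removeBox λ′ i) []) sizes′
          (paths-through-≤ K (removeBox λ′ i) μ λ′↓ μ↓ μ⊆λ′ sizes′)

pathsBelow-≤ : ∀ K a ν μ m j →
  (∀ {i} → IsCorner ν (drop 1 μ) i → paths K (a ∷ removeBox ν i) μ ≤ m * paths j (removeBox ν i) (drop 1 μ)) →
  pathsBelow K a ν μ ≤ m * paths (suc j) ν (drop 1 μ)
pathsBelow-≤ K a ν μ m j bound =
  ≤-trans (sum-map-mono (corners ν (drop 1 μ)) (bound ∘ to (∈-corners⇔ ν (drop 1 μ))))
          (≤-reflexive (sym (*-sum-map m (λ i → paths j (removeBox ν i) (drop 1 μ)) (corners ν (drop 1 μ)))))

pathsBelow-≥ : ∀ K a ν μ m j →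
  (∀ {i} → IsCorner ν (drop 1 μ) i → m * paths j (removeBox ν i) (drop 1 μ) ≤ paths K (a ∷ removeBox ν i) μ) →
  m * paths (suc j) ν (drop 1 μ) ≤ pathsBelow K a ν μ
pathsBelow-≥ K a ν μ m j bound =
  ≤-trans (≤-reflexive (*-sum-map m (λ i → paths j (removeBox ν i) (drop 1 μ)) (corners ν (drop 1 μ))))
          (sum-map-mono (corners ν (drop 1 μ)) (bound ∘ to (∈-corners⇔ ν (drop 1 μ))))

paths≤C*paths-drop1 : ∀ K l λ′ μ → IsDiagram λ′ → IsDiagram μ → μ ⊆ᴾ λ′ →
  size λ′ ≡ size μ + K → size (drop 1 λ′) ≡ size (drop 1 μ) + l →
  paths K λ′ μ ≤ (K C l) * paths l (drop 1 λ′) (drop 1 μ)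
paths≤C*paths-drop1 zero    zero    λ′ μ _ _ _ _ _ = ≤-refl
paths≤C*paths-drop1 zero    (suc l) λ′ μ _ _ μ⊆λ sizes sizes₁ =
  ⊥-elim (<-irrefl (sym (trans sizes (+-identityʳ (size μ)))) (subst₂ _<_ (sym (size-∷ μ)) (sym (size-∷ λ′))
    (+-mono-≤-< (μ⊆λ 0) (subst (size (drop 1 μ) <_) (sym sizes₁) (m<m+n (size (drop 1 μ)) (s≤s z≤n))))))
paths≤C*paths-drop1 (suc K) l []      μ _ _ _ sizes _ = ⊥-elim (0≢1+n (trans sizes (+-suc (size μ) K)))
paths≤C*paths-drop1 (suc K) l (x ∷ λ̄) μ λ↓ μ↓ μ⊆λ sizes sizes₁ = ≤-trans firstRow (otherRows l sizes₁)
  where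
  firstRow : paths (suc K) (x ∷ λ̄) μ ≤ (K C l) * paths l λ̄ (drop 1 μ) + pathsBelow K x λ̄ μ
  firstRow with (row μ 0 <? x) ×-dec (row λ̄ 0 <? x)
  ... | no  ¬corner = ≤-trans (≤-reflexive (paths-∷-nonCorner K x λ̄ μ ¬corner)) (m≤n+m _ _)
  ... | yes corner  = let λ′↓ , μ⊆λ′ , sizes′ = removeCorner (x ∷ λ̄) μ λ↓ μ⊆λ sizes corner in
    ≤-trans (≤-reflexive (paths-∷-corner K x λ̄ μ corner))
            (+-monoˡ-≤ (pathsBelow K x λ̄ μ) (paths≤C*paths-drop1 K l (pred x ∷ λ̄) μ λ′↓ μ↓ μ⊆λ′ sizes′ sizes₁))
  otherRows : ∀ l → size λ̄ ≡ size (drop 1 μ) + l →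
    (K C l) * paths l λ̄ (drop 1 μ) + pathsBelow K x λ̄ μ ≤ (suc K C l) * paths l λ̄ (drop 1 μ)
  otherRows zero    sizes₁
    rewrite corners-full λ̄ (drop 1 μ) (⊆ᴾ-drop1 μ (x ∷ λ̄) μ⊆λ) (trans sizes₁ (+-identityʳ _)) = ≤-refl
  otherRows (suc l) sizes₁ = begin
    (K C suc l) * P + pathsBelow K x λ̄ μ ≤⟨ +-monoʳ-≤ ((K C suc l) * P) (pathsBelow-≤ K x λ̄ μ (K C l) l step) ⟩
    (K C suc l) * P + (K C l) * P        ≡⟨ +-comm ((K C suc l) * P) ((K C l) * P) ⟩
    (K C l) * P + (K C suc l) * P        ≡⟨ *-distribʳ-+ P (K C l) (K C suc l) ⟨
    (K C l + K C suc l) * P              ≡⟨ cong (_* P) (nCk+nC[k+1]≡[n+1]C[k+1] K l) ⟩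
    (suc K C suc l) * P                  ∎
    where
    open ≤-Reasoning
    P = paths (suc l) λ̄ (drop 1 μ)
    step : ∀ {c} → IsCorner λ̄ (drop 1 μ) c →
      paths K (x ∷ removeBox λ̄ c) μ ≤ (K C l) * paths l (removeBox λ̄ c) (drop 1 μ)
    step {c} corner@(μ<λ , _) =
      let λ′↓ , μ⊆λ′ , sizes′ = removeCorner (x ∷ λ̄) μ λ↓ μ⊆λ sizes (IsCorner-∷ x λ̄ μ corner) in
      paths≤C*paths-drop1 K l (x ∷ removeBox λ̄ c) μ λ′↓ μ↓ μ⊆λ′ sizes′
        (suc-injective (trans (size-removeBox λ̄ c (≤-<-trans z≤n μ<λ)) (trans sizes₁ (+-suc _ l))))

row0≤size : ∀ ν → row ν 0 ≤ size ν
row0≤size ν = subst (row ν 0 ≤_) (sym (size-∷ ν)) (m≤m+n (row ν 0) _)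

C*paths≤paths-∷ : ∀ N a ν j → IsDiagram (a ∷ ν) → size ν ≡ j → a + j ≡ N →
  (a C j) * paths j ν [] ≤ paths N (a ∷ ν) []
C*paths≤paths-∷ zero    zero    ν zero    _  _     _     = ≤-refl
C*paths≤paths-∷ (suc N) a       ν zero    a↓ sizes a+0≡N with refl ← trans (sym (+-identityʳ a)) a+0≡N = begin
  (suc N C 0) * paths 0 ν []                     ≤⟨ C*paths≤paths-∷ N N ν 0 N↓ sizes (+-identityʳ N) ⟩
  paths N (N ∷ ν) []                             ≤⟨ m≤m+n _ _ ⟩
  paths N (N ∷ ν) [] + pathsBelow N (suc N) ν [] ≡⟨ paths-∷-corner N (suc N) ν [] corner ⟨
  paths (suc N) (suc N ∷ ν) []                   ∎
  where
  open ≤-Reasoning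
  corner : IsCorner (suc N ∷ ν) [] 0
  corner = s≤s z≤n , s≤s (≤-trans (subst (row ν 0 ≤_) sizes (row0≤size ν)) z≤n)
  N↓ : IsDiagram (N ∷ ν)
  N↓ = IsDiagram-removeBox (suc N ∷ ν) 0 a↓ (proj₂ corner)
C*paths≤paths-∷ (suc N) zero    ν (suc j) _  _     _     = z≤n
C*paths≤paths-∷ (suc N) (suc a) ν (suc j) a↓ sizes a+j≡N = byCorner (row ν 0 <? suc a)
  where
  open ≤-Reasoning
  P = paths (suc j) ν []
  below : (suc a C j) * P ≤ pathsBelow N (suc a) ν []
  below = pathsBelow-≥ N (suc a) ν [] (suc a C j) j λ {c} corner@(ν꜀>0 , _) →
    C*paths≤paths-∷ N (suc a) (removeBox ν c) j (IsDiagram-removeBox (suc a ∷ ν) (suc c) a↓ (proj₂ corner))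
      (suc-injective (trans (size-removeBox ν c ν꜀>0) sizes)) (suc-injective (trans (sym (+-suc (suc a) j)) a+j≡N))
  byCorner : Dec (row ν 0 < suc a) → (suc a C suc j) * P ≤ paths (suc N) (suc a ∷ ν) []
  byCorner (no ν₀≮1+a) = begin
    (suc a C suc j) * P           ≤⟨ *-monoˡ-≤ P (C-antitone (suc a) j a+1≤j+1) ⟩
    (suc a C j) * P               ≤⟨ below ⟩
    pathsBelow N (suc a) ν []     ≡⟨ paths-∷-nonCorner N (suc a) ν [] (ν₀≮1+a ∘ proj₂) ⟨
    paths (suc N) (suc a ∷ ν) []  ∎
    where
    a+1≤j+1 : suc a ≤ suc j
    a+1≤j+1 = ≤-trans (≮⇒≥ ν₀≮1+a) (subst (row ν 0 ≤_) sizes (row0≤size ν))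
  byCorner (yes ν₀<1+a) = begin
    (suc a C suc j) * P                            ≡⟨ cong (_* P) (nCk+nC[k+1]≡[n+1]C[k+1] a j) ⟨
    (a C j + a C suc j) * P                        ≡⟨ *-distribʳ-+ P (a C j) (a C suc j) ⟩
    (a C j) * P + (a C suc j) * P                  ≤⟨ +-mono-≤ (≤-trans (*-monoˡ-≤ P (C-mono a j)) below) top ⟩
    pathsBelow N (suc a) ν [] + paths N (a ∷ ν) [] ≡⟨ +-comm (pathsBelow N (suc a) ν []) _ ⟩
    paths N (a ∷ ν) [] + pathsBelow N (suc a) ν [] ≡⟨ paths-∷-corner N (suc a) ν [] (s≤s z≤n , ν₀<1+a) ⟨
    paths (suc N) (suc a ∷ ν) []                   ∎
    where
    top : (a C suc j) * P ≤ paths N (a ∷ ν) []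
    top = C*paths≤paths-∷ N a ν (suc j) (IsDiagram-removeBox (suc a ∷ ν) 0 a↓ ν₀<1+a) sizes (suc-injective a+j≡N)

paths-through-≤-drop1 : ∀ a λ̄ μ k l → IsDiagram (a ∷ λ̄) → IsDiagram μ → μ ⊆ᴾ (a ∷ λ̄) →
  a + size λ̄ ≡ size μ + k → size λ̄ ≡ size (drop 1 μ) + l →
  paths (size μ) μ [] * paths k (a ∷ λ̄) μ ≤ (size μ C size (drop 1 μ)) * (k C l) * paths (size λ̄) λ̄ []
paths-through-≤-drop1 a λ̄ μ k l λ↓ μ↓ μ⊆λ sizes sizes₁ = begin
  paths (size μ) μ [] * paths k (a ∷ λ̄) μ
    ≤⟨ *-mono-≤ (paths≤C*paths-drop1 (size μ) m μ [] μ↓ (λ _ → z≤n) (λ _ → z≤n) refl refl)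
                (paths≤C*paths-drop1 k l (a ∷ λ̄) μ λ↓ μ↓ μ⊆λ sizes sizes₁) ⟩
  ((size μ C m) * paths m μ̄ []) * ((k C l) * paths l λ̄ μ̄)
    ≡⟨ interchange-* (size μ C m) (paths m μ̄ []) (k C l) (paths l λ̄ μ̄) ⟩
  (size μ C m) * (k C l) * (paths m μ̄ [] * paths l λ̄ μ̄)
    ≤⟨ *-monoʳ-≤ ((size μ C m) * (k C l))
         (paths-through-≤ l λ̄ μ̄ (IsDiagram-drop1 {a ∷ λ̄} λ↓) (IsDiagram-drop1 {μ} μ↓)
                                 (⊆ᴾ-drop1 μ (a ∷ λ̄) μ⊆λ) sizes₁) ⟩
  (size μ C m) * (k C l) * paths (size λ̄) λ̄ [] ∎
  where
  open ≤-Reasoning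
  μ̄ = drop 1 μ
  m = size μ̄
  interchange-* : ∀ w x y z → w * x * (y * z) ≡ w * y * (x * z)
  interchange-* = solve-∀

size-lowerRows : ∀ a λ̄ μ k → a + size λ̄ ≡ size μ + k → a < k + row μ 0 →
  size λ̄ ≡ size (drop 1 μ) + (k + row μ 0 ∸ a)
size-lowerRows a λ̄ μ k sizes a<k+μ₀ = +-cancelˡ-≡ a _ _ (begin
  a + size λ̄           ≡⟨ sizes ⟩
  size μ + k            ≡⟨ cong (_+ k) (size-∷ μ) ⟩
  row μ 0 + m + k       ≡⟨ regroup₁ (row μ 0) m k ⟩
  m + (k + row μ 0)     ≡⟨ cong (m +_) (m∸n+n≡m (<⇒≤ a<k+μ₀)) ⟨
  m + (l + a)           ≡⟨ regroup₂ m l a ⟩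
  a + (m + l)           ∎)
  where
  open ≡-Reasoning
  m = size (drop 1 μ)
  l = k + row μ 0 ∸ a
  regroup₁ : ∀ x y z → x + y + z ≡ y + (z + x)
  regroup₁ = solve-∀
  regroup₂ : ∀ x y z → x + (y + z) ≡ z + (x + y)
  regroup₂ = solve-∀

paths-bound : ∀ a λ̄ μ n k → IsDiagram (a ∷ λ̄) → IsDiagram μ → μ ⊆ᴾ (a ∷ λ̄) →
  a + size λ̄ ≡ n → 1 ≤ k → size μ + k ≡ n → a < k + row μ 0 →
  paths (size μ) μ [] * paths k (a ∷ λ̄) μ * n ^ (k + row μ 0 ∸ a)
    ≤ (4 ^ (n ∸ a) * k) ^ (k + row μ 0 ∸ a) * paths n (a ∷ λ̄) []
paths-bound a λ̄ μ n k λ↓ μ↓ μ⊆λ refl 1≤k sizes a<k+μ₀ rewrite m+n∸m≡n a (size λ̄) with n ≤? 4 ^ size λ̄ * k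
... | yes n≤4ʲk = begin
  paths (size μ) μ [] * paths k (a ∷ λ̄) μ * n ^ l
    ≤⟨ *-mono-≤ (paths-through-≤ k (a ∷ λ̄) μ λ↓ μ↓ μ⊆λ (sym sizes)) (^-monoˡ-≤ l n≤4ʲk) ⟩
  paths n (a ∷ λ̄) [] * (4 ^ j * k) ^ l
    ≡⟨ *-comm (paths n (a ∷ λ̄) []) _ ⟩
  (4 ^ j * k) ^ l * paths n (a ∷ λ̄) []
    ∎
  where
  open ≤-Reasoning
  j = size λ̄
  l = k + row μ 0 ∸ a
... | no n≰4ʲk = begin
  paths (size μ) μ [] * paths k (a ∷ λ̄) μ * n ^ l
    ≤⟨ *-monoˡ-≤ (n ^ l) (paths-through-≤-drop1 a λ̄ μ k l λ↓ μ↓ μ⊆λ (sym sizes) λ̄-size) ⟩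
  (size μ C m) * (k C l) * paths j λ̄ [] * n ^ l
    ≡⟨ regroup (size μ C m) (k C l) (paths j λ̄ []) (n ^ l) ⟩
  (size μ C m) * (k C l) * n ^ l * paths j λ̄ []
    ≤⟨ *-monoˡ-≤ (paths j λ̄ []) (binomial-bound refl (sym λ̄-size) (m<n⇒0<n∸m a<k+μ₀) 1≤k μ≤n (≰⇒> n≰4ʲk)) ⟩
  (4 ^ j * k) ^ l * (a C j) * paths j λ̄ []
    ≡⟨ *-assoc ((4 ^ j * k) ^ l) (a C j) (paths j λ̄ []) ⟩
  (4 ^ j * k) ^ l * ((a C j) * paths j λ̄ [])
    ≤⟨ *-monoʳ-≤ ((4 ^ j * k) ^ l) (C*paths≤paths-∷ n a λ̄ j λ↓ refl refl) ⟩
  (4 ^ j * k) ^ l * paths n (a ∷ λ̄) []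
    ∎
  where
  open ≤-Reasoning
  j = size λ̄
  l = k + row μ 0 ∸ a
  m = size (drop 1 μ)
  λ̄-size : j ≡ m + l
  λ̄-size = size-lowerRows a λ̄ μ k (sym sizes) a<k+μ₀
  μ≤n : size μ ≤ n
  μ≤n = subst (size μ ≤_) sizes (m≤m+n (size μ) k)
  regroup : ∀ w x y z → w * x * y * z ≡ w * x * z * y
  regroup = solve-∀

lemma7p1 : (λ′ μ : List ℕ) (n k : ℕ) →
    IsPartition λ′ → size λ′ ≡ n →
    1 ≤ k → k ≤ n →
    IsPartition μ → size μ + k ≡ n → μ ⊆ᴾ λ′ →
    row λ′ 0 < k + row μ 0 →
    d μ * dSkew λ′ μ * n ^ (k + row μ 0 ∸ row λ′ 0)
      ≤ (4 ^ (n ∸ row λ′ 0) * k) ^ (k + row μ 0 ∸ row λ′ 0) * d λ′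
lemma7p1 []       μ n k _ refl 1≤k k≤0 _ _ _ _ with () ← ≤-trans 1≤k k≤0
lemma7p1 (a ∷ λ̄) μ n k λ-partition λ-size 1≤k _ μ-partition μ-size μ⊆λ a<k+μ₀ =
  subst₂ _≤_ (cong₂ (λ x y → x * y * n ^ (k + row μ 0 ∸ a)) (sym (d≡paths μ μ↓)) (sym skew))
             (cong ((4 ^ (n ∸ a) * k) ^ (k + row μ 0 ∸ a) *_) (sym whole))
    (paths-bound a λ̄ μ n k λ↓ μ↓ μ⊆λ λ-size 1≤k μ-size a<k+μ₀)
  where
  λ↓ = IsPartition⇒IsDiagram λ-partition
  μ↓ = IsPartition⇒IsDiagram μ-partition
  skew : dSkew (a ∷ λ̄) μ ≡ paths k (a ∷ λ̄) μ
  skew = trans (dSkew≡paths (a ∷ λ̄) μ λ↓ μ↓ μ⊆λ) (cong (λ K → paths K (a ∷ λ̄) μ) (begin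
    size (a ∷ λ̄) ∸ size μ ≡⟨ cong (_∸ size μ) (trans λ-size (sym μ-size)) ⟩
    size μ + k ∸ size μ    ≡⟨ m+n∸m≡n (size μ) k ⟩
    k                      ∎))
    where open ≡-Reasoning
  whole : d (a ∷ λ̄) ≡ paths n (a ∷ λ̄) []
  whole = trans (d≡paths (a ∷ λ̄) λ↓) (cong (λ K → paths K (a ∷ λ̄) []) λ-size)
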